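{- For every $n\ge 3$, the induced greedy colex process for the butterfly poset $\bowtie$ on ground set $[n]$ outputs exactly the family $\mathcal H_n$. In particular, $\mathrm{sat}^*(n,\bowtie)\le 6n-10$.
   Context: The butterfly $\bowtie$ is the poset on four elements $a,b,c,d$ with $a<c$, $a<d$, $b<c$, $b<d$ and no other relations. A subfamily $\mathcal G\subseteq\mathcal F\subseteq 2^{[n]}$ is an induced copy of a poset $P$ if there is a bijection $i:P\to\mathcal G$ with $p\le_P q$ iff $i(p)\subseteq i(q)$; $\mathcal F$ is induced $P$-saturating if it has no induced copy of $P$ and adding any $G\in2^{[n]}\setminus\mathcal F$ creates one; $\mathrm{sat}^*(n,P)$ is the minimum size of such a family. Colex order: $A<B$ iff $\max(A\triangle B)\in B$. Induced greedy colex process for $P$ on $[n]$: enumerate $2^{[n-1]}$ in colex order as $F_1,\dots,F_{2^{n-1}}$, let $G_i=[n]\setminus F_i$, start with $\mathcal F_0=\emptyset$; for $i=1,\dots,2^{n-1}$, first add $F_i$ to the current family if the result has no induced copy of $P$, then add $G_i$ if the result has no induced copy of $P$; the resulting family is $\mathcal F_i$, and the output is $\mathcal F_{2^{n-1}}$. Define $\mathcal T_1=\{\emptyset\}$, $\mathcal T_2=\{\{1\},\{2\},\{1,2\}\}$, $\mathcal T_3=\{\{3\},\{1,3\},\{2,3\}\}$, and for $k\ge2$: $\mathcal T_{2k}=\{\{1,4,6,\dots,2k\},\{2,4,6,\dots,2k\},\{1,2,4,6,\dots,2k\}\}$ and $\mathcal T_{2k+1}=\{\{3,5,\dots,2k+1\},\{1,3,5,\dots,2k+1\},\{2,3,5,\dots,2k+1\}\}$.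 For $1\le j<n$ let $\mathcal T_{j,n}=\{[n]\setminus T: T\in\mathcal T_j\}$, and $\mathcal H_n=\bigcup_{j=1}^{n-1}(\mathcal T_j\cup\mathcal T_{j,n})$. -}

module Defs where

open import Data.Nat using (ℕ; zero; suc; _+_; _*_; _∸_; _≡ᵇ_)
open import Data.Nat.DivMod using (_/_; _%_)
open import Data.Bool using (Bool; true; false; if_then_else_)
open import Data.Fin using (Fin; toℕ)
open import Data.Vec using (Vec; []; _∷_; _∷ʳ_; tabulate)
open import Data.List using (List; []; _∷_; map; concatMap; _++_; upTo; length)
open import Data.Bool.ListAction using (any)
open import Data.List.Membership.Propositional using () renaming (_∈_ to _∈ₗ_; _∉_ to _∉ₗ_)
open import Data.Fin.Subset using (Subset; inside; outside; ∁; _⊆_)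
open import Data.Product using (Σ; _×_)
open import Relation.Nullary using (¬_)
open import Relation.Binary.PropositionalEquality using (_≡_; _≢_)

-- Convention: Subset n = Vec Bool n; Fin index i (0-based) stands for element i+1 of [n].

record IsInducedButterfly {n : ℕ} (a b c d : Subset n) : Set where
  field
    a≢b : a ≢ b
    a≢c : a ≢ c
    a≢d : a ≢ d
    b≢c : b ≢ c
    b≢d : b ≢ d
    c≢d : c ≢ d
    a⊆c : a ⊆ c
    a⊆d : a ⊆ d
    b⊆c : b ⊆ c
    b⊆d : b ⊆ d
    a⊈b : ¬ (a ⊆ b)
    b⊈a : ¬ (b ⊆ a)
    c⊈d : ¬ (c ⊆ d)
    d⊈c : ¬ (d ⊆ c)
    c⊈a : ¬ (c ⊆ a)
    d⊈a : ¬ (d ⊆ a)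
    c⊈b : ¬ (c ⊆ b)
    d⊈b : ¬ (d ⊆ b)

HasInducedButterfly : {n : ℕ} → List (Subset n) → Set
HasInducedButterfly {n} F =
  Σ (Subset n) λ a → Σ (Subset n) λ b → Σ (Subset n) λ c → Σ (Subset n) λ d →
    a ∈ₗ F × b ∈ₗ F × c ∈ₗ F × d ∈ₗ F × IsInducedButterfly a b c d

IsButterflySaturating : {n : ℕ} → List (Subset n) → Set
IsButterflySaturating {n} F =
  ¬ HasInducedButterfly F × ((G : Subset n) → G ∉ₗ F → HasInducedButterfly (G ∷ F))

-- Index 0 (element 1) is the head of the vector, so the "largest" element is the
-- last one; colex order is lexicographic order on the tail, then the head.
colex : (m : ℕ) → List (Subset m)
colex zero = [] ∷ []
colex (suc m) = concatMap (λ r → (outside ∷ r) ∷ (inside ∷ r) ∷ []) (colex m)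

colexLow : (n : ℕ) → List (Subset n)
colexLow zero = []
colexLow (suc m) = map (λ r → r ∷ʳ outside) (colex m)

data TryAdd {n : ℕ} (F : List (Subset n)) (X : Subset n) : List (Subset n) → Set where
  added   : ¬ HasInducedButterfly (X ∷ F) → TryAdd F X (X ∷ F)
  skipped : HasInducedButterfly (X ∷ F) → TryAdd F X F

data Run {n : ℕ} : List (Subset n) → List (Subset n) → List (Subset n) → Set where
  done : {F : List (Subset n)} → Run F [] F
  step : {F F′ F″ R : List (Subset n)} {X : Subset n} {Xs : List (Subset n)} →
         TryAdd F X F′ → TryAdd F′ (∁ X) F″ → Run F″ Xs R → Run F (X ∷ Xs) R

GreedyColexOutput : (n : ℕ) → List (Subset n) → Set
GreedyColexOutput n R = Run [] (colexLow n) R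

-- subset of [n] from a list of (1-based) elements
fromElems : {n : ℕ} → List ℕ → Subset n
fromElems xs = tabulate (λ i → if any (λ x → x ≡ᵇ suc (toℕ i)) xs then inside else outside)

evens : ℕ → List ℕ
evens k = map (λ i → 2 * (i + 2)) (upTo (k ∸ 1))

odds : ℕ → List ℕ
odds k = map (λ i → 2 * (i + 1) + 1) (upTo k)

T : ℕ → List (List ℕ)
T 0 = []
T 1 = [] ∷ []
T 2 = (1 ∷ []) ∷ (2 ∷ []) ∷ (1 ∷ 2 ∷ []) ∷ []
T 3 = (3 ∷ []) ∷ (1 ∷ 3 ∷ []) ∷ (2 ∷ 3 ∷ []) ∷ []
T j@(suc (suc (suc (suc _)))) with j % 2
... | 0 = (1 ∷ evens (j / 2)) ∷ (2 ∷ evens (j / 2)) ∷ (1 ∷ 2 ∷ evens (j / 2)) ∷ []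
... | _ = odds (j / 2) ∷ (1 ∷ odds (j / 2)) ∷ (2 ∷ odds (j / 2)) ∷ []

H : (n : ℕ) → List (Subset n)
H n = concatMap (λ i → let j = suc i in map fromElems (T j) ++ map (λ t → ∁ (fromElems t)) (T j))
                (upTo (n ∸ 1))

-- Every member of H_n is the set of a code, a subset of {1, 2} followed by an initial segment
-- of the chain 3, 5, 7, … or 4, 6, 8, … (under the side conditions of the T_j), or the
-- complement of such a set; a case analysis on prefixes and chains shows that H_n has no
-- induced butterfly. Conversely, every X ⊆ [n - 1] outside H_n forms an induced butterfly with
-- members of H_n that precede it in colex order. Such a member R incomparable to X is ∁{3} or {3}
-- if X contains all or none of 1, 2, 3; otherwise it agrees with X on {1, 2, 3} and is read off
-- the first place where X leaves the chain whose parity is fixed by whether 3 ∈ X. If X contains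
-- two elements i, j ≤ 3, then {i}, {j} lie below X and R; otherwise X and R lie below ∁{i}, ∁{j}
-- for two elements i, j ≤ 3 missing from X. As the process treats F_i and ∁ F_i together and
-- H_n is closed under complements, it accepts exactly the pairs lying in H_n.
module Submission where

open import Defs
open import Data.Bool as Bool using (Bool; true; false; not; _∧_; _∨_; if_then_else_)
open import Data.Bool.ListAction using (any)
import Data.Bool.Properties as Boolₚ
open import Data.Empty using (⊥; ⊥-elim)
open import Data.Fin using (Fin; toℕ; fromℕ<) renaming (zero to fzero; suc to fsuc)
open import Data.Fin.Patterns using (0F; 1F; 2F)
open import Data.Fin.Properties using (toℕ-fromℕ<; toℕ<n)
open import Data.Fin.Subset using (Subset; ∁; _⊆_) renaming (_∈_ to _∈ₛ_)
import Data.Fin.Subset.Properties as Subsetₚ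
open import Data.List as List using (List; []; _∷_; _++_; map; concatMap; applyUpTo; upTo; length; deduplicate)
import Data.List.Membership.DecPropositional as DecMembership
open import Data.List.Membership.Propositional using (_∈_; find; lose)
open import Data.List.Membership.Propositional.Properties
  using (∈-map⁺; ∈-map⁻; ∈-++⁺ˡ; ∈-++⁺ʳ; ∈-++⁻; ∈-upTo⁺; ∈-upTo⁻; ∈-concatMap⁺; ∈-concatMap⁻;
         ∈-deduplicate⁺; ∈-deduplicate⁻)
import Data.List.Properties as Listₚ
open import Data.List.Relation.Unary.All as All using (All; []; _∷_)
open import Data.List.Relation.Unary.Any as Any using (here; there)
open import Data.List.Relation.Unary.Any.Properties using (any⁺; any⁻)
open import Data.List.Relation.Unary.Unique.Propositional using (Unique)
import Data.List.Relation.Unary.Unique.DecPropositional.Properties as UniqueDecₚ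
open import Data.Nat using (ℕ; zero; suc; _+_; _*_; _∸_; _^_; _≤_; _<_; _≡ᵇ_; _<?_; z≤n; s≤s)
open import Data.Nat.DivMod using (_/_; _%_; [m+kn]%n≡m%n; m*n/n≡m; m*n%n≡0; +-distrib-/)
open import Data.Nat.Properties
open import Data.Product as Product using (Σ; _×_; _,_; proj₁; proj₂)
open import Data.Sum as Sum using (_⊎_; inj₁; inj₂)
open import Data.Unit using (⊤; tt)
open import Data.Vec using (Vec; []; _∷_; _∷ʳ_; tabulate; here; there)
import Data.Vec.Properties as Vecₚ
open import Function using (_∘_)
open import Function.Bundles using (_⇔_; mk⇔; Equivalence)
open import Relation.Binary.Definitions using (tri<; tri≈; tri>)
open import Relation.Binary.PropositionalEquality
open import Relation.Nullary using (¬_; ¬?; Dec; yes; no; contradiction; _×-dec_; decidable-stable)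
import Relation.Nullary.Decidable as Dec

-- Subsets as bit strings, and their binary value

infixl 9 _!_

_!_ : ∀ {n} → Vec Bool n → ℕ → Bool
[] ! _ = false
(b ∷ v) ! zero = b
(b ∷ v) ! suc p = v ! p

true≢false : true ≢ false
true≢false ()

!-≥ : ∀ {n} (v : Vec Bool n) {p} → n ≤ p → v ! p ≡ false
!-≥ [] _ = refl
!-≥ (b ∷ v) (s≤s n≤p) = !-≥ v n≤p

!⇒< : ∀ {n} (v : Vec Bool n) {p} → v ! p ≡ true → p < n
!⇒< {n} v {p} vp with p <? n
... | yes p<n = p<n
... | no p≮n = contradiction (trans (sym vp) (!-≥ v (≮⇒≥ p≮n))) true≢false

some-from : ∀ {n} (v : Vec Bool n) t → (Σ ℕ λ s → t ≤ s × v ! s ≡ true) ⊎ (∀ s → t ≤ s → v ! s ≡ false)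
some-from [] t = inj₂ λ _ _ → refl
some-from (true ∷ v) zero = inj₁ (0 , z≤n , refl)
some-from (false ∷ v) zero with some-from v 0
... | inj₁ (s , _ , vs) = inj₁ (suc s , z≤n , vs)
... | inj₂ none = inj₂ λ { zero _ → refl ; (suc s) _ → none s z≤n }
some-from (b ∷ v) (suc t) with some-from v t
... | inj₁ (s , t≤s , vs) = inj₁ (suc s , s≤s t≤s , vs)
... | inj₂ none = inj₂ λ { (suc s) (s≤s t≤s) → none s t≤s }

!-ext : ∀ {n} (v w : Vec Bool n) → (∀ p → v ! p ≡ w ! p) → v ≡ w
!-ext [] [] _ = refl
!-ext (a ∷ v) (b ∷ w) eq = cong₂ _∷_ (eq 0) (!-ext v w (eq ∘ suc))

∈⇒! : ∀ {n} {v : Subset n} {i} → i ∈ₛ v → v ! toℕ i ≡ true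
∈⇒! here = refl
∈⇒! (there i∈v) = ∈⇒! i∈v

!⇒∈ : ∀ {n} (v : Subset n) i → v ! toℕ i ≡ true → i ∈ₛ v
!⇒∈ (true ∷ v) fzero refl = here
!⇒∈ (b ∷ v) (fsuc i) vi = there (!⇒∈ v i vi)

!-∁ : ∀ {n} (v : Vec Bool n) {p} → p < n → ∁ v ! p ≡ not (v ! p)
!-∁ (b ∷ v) {zero} _ = refl
!-∁ (b ∷ v) {suc p} (s≤s p<n) = !-∁ v p<n

!-tabulate : ∀ {n} (f : ℕ → Bool) {p} → p < n → tabulate {n = n} (λ i → f (toℕ i)) ! p ≡ f p
!-tabulate {suc n} f {zero} _ = refl
!-tabulate {suc n} f {suc p} (s≤s p<n) = !-tabulate (λ q → f (suc q)) p<n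

∁-involutive : ∀ {n} (v : Vec Bool n) → ∁ (∁ v) ≡ v
∁-involutive [] = refl
∁-involutive (b ∷ v) = cong₂ _∷_ (Boolₚ.not-involutive b) (∁-involutive v)

infix 4 _⊆!_

record _⊆!_ {n} (v w : Vec Bool n) : Set where
  constructor ⊆!⁺
  field ⊆!⁻ : ∀ p → v ! p ≡ true → w ! p ≡ true
open _⊆!_

⊆!-refl : ∀ {n} {v : Vec Bool n} → v ⊆! v
⊆!-refl = ⊆!⁺ λ _ vp → vp

⊆!-trans : ∀ {n} {u v w : Vec Bool n} → u ⊆! v → v ⊆! w → u ⊆! w
⊆!-trans u⊆v v⊆w = ⊆!⁺ λ p → ⊆!⁻ v⊆w p ∘ ⊆!⁻ u⊆v p

⊆!-tail : ∀ {n a b} {v w : Vec Bool n} → (a ∷ v) ⊆! (b ∷ w) → v ⊆! w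
⊆!-tail av⊆bw = ⊆!⁺ (⊆!⁻ av⊆bw ∘ suc)

⊆!⇒⊆ : ∀ {n} {v w : Subset n} → v ⊆! w → v ⊆ w
⊆!⇒⊆ {w = w} v⊆w {i} i∈v = !⇒∈ w i (⊆!⁻ v⊆w (toℕ i) (∈⇒! i∈v))

⊆⇒⊆! : ∀ {n} {v w : Subset n} → v ⊆ w → v ⊆! w
⊆⇒⊆! {n} {v} {w} v⊆w = ⊆!⁺ λ p vp → let p<n = !⇒< v vp in begin
    w ! p                       ≡⟨ cong (w !_) (toℕ-fromℕ< p<n) ⟨
    w ! toℕ (fromℕ< p<n)        ≡⟨ ∈⇒! (v⊆w (!⇒∈ v _ (trans (cong (v !_) (toℕ-fromℕ< p<n)) vp))) ⟩
    true                        ∎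
  where open ≡-Reasoning

⊈-witness : ∀ {n} {v w : Vec Bool n} p → v ! p ≡ true → w ! p ≡ false → ¬ v ⊆! w
⊈-witness p vp wp v⊆w = true≢false (trans (sym (⊆!⁻ v⊆w p vp)) wp)

∁-antitone : ∀ {n} {v w : Subset n} → v ⊆! w → ∁ w ⊆! ∁ v
∁-antitone v⊆w = ⊆⇒⊆! (Subsetₚ.p⊆q⇒∁p⊇∁q (⊆!⇒⊆ v⊆w))

bit : Bool → ℕ
bit false = 0
bit true = 1

binary : ∀ {n} → Vec Bool n → ℕ
binary [] = 0
binary (b ∷ v) = bit b + binary v * 2

bit≤1 : ∀ b → bit b ≤ 1
bit≤1 false = z≤n
bit≤1 true = s≤s z≤n

bit-mono : ∀ {a b} → (a ≡ true → b ≡ true) → bit a ≤ bit b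
bit-mono {false} _ = z≤n
bit-mono {true} a⇒b rewrite a⇒b refl = ≤-refl

digit-< : ∀ x y {a b} → x ≤ 1 → a < b → x + a * 2 < y + b * 2
digit-< x y {a} {b} x≤1 a<b = begin-strict
    x + a * 2   ≤⟨ +-monoˡ-≤ (a * 2) x≤1 ⟩
    1 + a * 2   <⟨ n<1+n _ ⟩
    suc a * 2   ≤⟨ *-monoˡ-≤ 2 a<b ⟩
    b * 2       ≤⟨ m≤n+m (b * 2) y ⟩
    y + b * 2   ∎
  where open ≤-Reasoning

binary<2^ : ∀ {n} (w : Vec Bool n) t → (∀ q → t ≤ q → w ! q ≡ false) → binary w < 2 ^ t
binary<2^ [] t _ = m^n>0 2 t
binary<2^ (b ∷ w) zero vanish
  rewrite vanish 0 z≤n | n<1⇒n≡0 (binary<2^ w 0 (λ q _ → vanish (suc q) z≤n)) = s≤s z≤n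
binary<2^ (b ∷ w) (suc t) vanish = begin-strict
    bit b + binary w * 2   <⟨ digit-< (bit b) 0 (bit≤1 b) (binary<2^ w t (λ q t≤q → vanish (suc q) (s≤s t≤q))) ⟩
    2 ^ t * 2              ≡⟨ *-comm (2 ^ t) 2 ⟩
    2 ^ suc t              ∎
  where open ≤-Reasoning

2^≤binary : ∀ {n} (v : Vec Bool n) q → v ! q ≡ true → 2 ^ q ≤ binary v
2^≤binary (true ∷ v) zero refl = s≤s z≤n
2^≤binary (b ∷ v) (suc q) vq = begin
    2 ^ suc q              ≡⟨ *-comm 2 (2 ^ q) ⟩
    2 ^ q * 2              ≤⟨ *-monoˡ-≤ 2 (2^≤binary v q vq) ⟩
    binary v * 2           ≤⟨ m≤n+m (binary v * 2) (bit b) ⟩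
    bit b + binary v * 2   ∎
  where open ≤-Reasoning

binary-<-above : ∀ {n} (v w : Vec Bool n) t {q} → (∀ r → t < r → w ! r ≡ false) →
                 v ! q ≡ true → t < q → binary w < binary v
binary-<-above v w t {q} w-vanish vq t<q =
  <-≤-trans (binary<2^ w (suc t) w-vanish) (≤-trans (^-monoʳ-≤ 2 t<q) (2^≤binary v q vq))

binary-mono : ∀ {n} (v w : Vec Bool n) → w ⊆! v → binary w ≤ binary v
binary-mono [] [] _ = z≤n
binary-mono (a ∷ v) (b ∷ w) w⊆v =
  +-mono-≤ (bit-mono (⊆!⁻ w⊆v 0)) (*-monoˡ-≤ 2 (binary-mono v w (⊆!-tail w⊆v)))

binary-<-⊂ : ∀ {n} (v w : Vec Bool n) {p} → w ⊆! v → v ! p ≡ true → w ! p ≡ false → binary w < binary v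
binary-<-⊂ (true ∷ v) (false ∷ w) {zero} w⊆v refl refl =
  s≤s (*-monoˡ-≤ 2 (binary-mono v w (⊆!-tail w⊆v)))
binary-<-⊂ (a ∷ v) (b ∷ w) {suc p} w⊆v vp wp =
  +-mono-≤-< (bit-mono (⊆!⁻ w⊆v 0)) (*-monoˡ-< 2 (binary-<-⊂ v w (⊆!-tail w⊆v) vp wp))

binary-<-highest-difference : ∀ {n} (v w : Vec Bool n) {p} → v ! p ≡ true → w ! p ≡ false →
                              (∀ q → p < q → v ! q ≡ w ! q) → binary w < binary v
binary-<-highest-difference (true ∷ v) (false ∷ w) {zero} refl refl agree
  rewrite !-ext v w (λ q → agree (suc q) (s≤s z≤n)) = n<1+n _
binary-<-highest-difference (a ∷ v) (b ∷ w) {suc p} vp wp agree =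
  digit-< (bit b) (bit a) (bit≤1 b) (binary-<-highest-difference v w vp wp (λ q p<q → agree (suc q) (s≤s p<q)))

bit+2 : ∀ π i → bit π + suc i * 2 ≡ suc (suc (bit π + i * 2))
bit+2 false i = refl
bit+2 true i = refl

halve : ℕ → Bool × ℕ
halve zero = false , 0
halve (suc zero) = true , 0
halve (suc (suc s)) = proj₁ (halve s) , suc (proj₂ (halve s))

halve-inverse : ∀ s → bit (proj₁ (halve s)) + proj₂ (halve s) * 2 ≡ s
halve-inverse zero = refl
halve-inverse (suc zero) = refl
halve-inverse (suc (suc s)) = trans (bit+2 (proj₁ (halve s)) (proj₂ (halve s))) (cong (suc ∘ suc) (halve-inverse s))

halve-bit : ∀ b i → halve (bit b + i * 2) ≡ (b , i)
halve-bit false zero = refl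
halve-bit true zero = refl
halve-bit b (suc i) rewrite bit+2 b i | halve-bit b i = refl

!-last-∁ : ∀ {m} (Y : Subset (suc m)) → Y ! m ≡ true → ∁ Y ! m ≡ false
!-last-∁ Y Ym = trans (!-∁ Y ≤-refl) (cong not Ym)

-- The colex position of the pair {Y, ∁ Y}: the binary value of the one avoiding the last element.
rank : ∀ {m} → Subset (suc m) → ℕ
rank {m} Y = binary (if Y ! m then ∁ Y else Y)

rank-low : ∀ {m} (Y : Subset (suc m)) → Y ! m ≡ false → rank Y ≡ binary Y
rank-low Y Ym rewrite Ym = refl

rank-∁ : ∀ {m} (Y : Subset (suc m)) → rank (∁ Y) ≡ rank Y
rank-∁ {m} Y with Y ! m in Ym
... | false rewrite trans (!-∁ Y ≤-refl) (cong not Ym) | ∁-involutive Y = refl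
... | true rewrite !-last-∁ Y Ym = refl

-- Codes of the members of the families T_j

-- Offsets q along a chain stand for the index 2 + q, i.e. the element q + 3. The chain of parity
-- false is 3, 5, 7, … and that of parity true is 4, 6, 8, …; inChain π k keeps its first k + 1 elements.

onChain : Bool → ℕ → Bool
onChain π zero = not π
onChain π (suc zero) = π
onChain π (suc (suc q)) = onChain π q

inChain : Bool → ℕ → ℕ → Bool
inChain π _ zero = not π
inChain π _ (suc zero) = π
inChain π zero (suc (suc q)) = false
inChain π (suc k) (suc (suc q)) = inChain π k q

onChain-not : ∀ π q → onChain (not π) q ≡ not (onChain π q)
onChain-not π zero = refl
onChain-not π (suc zero) = refl
onChain-not π (suc (suc q)) = onChain-not π q

onChain-suc : ∀ π q → onChain π (suc q) ≡ not (onChain π q)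
onChain-suc π zero = sym (Boolₚ.not-involutive π)
onChain-suc π (suc zero) = refl
onChain-suc π (suc (suc q)) = onChain-suc π q

onChain-bit : ∀ π i → onChain π (bit π + i * 2) ≡ true
onChain-bit false zero = refl
onChain-bit true zero = refl
onChain-bit π (suc i) rewrite bit+2 π i = onChain-bit π i

onChain⇒ : ∀ π q → onChain π q ≡ true → Σ ℕ λ i → q ≡ bit π + i * 2
onChain⇒ false zero _ = 0 , refl
onChain⇒ true (suc zero) _ = 0 , refl
onChain⇒ π (suc (suc q)) on with onChain⇒ π q on
... | i , refl = suc i , sym (bit+2 π i)

onChain⇒parity : ∀ π q → onChain π q ≡ true → π ≡ onChain true q
onChain⇒parity false zero _ = refl
onChain⇒parity true (suc zero) _ = refl
onChain⇒parity π (suc (suc q)) = onChain⇒parity π q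

offset-injective : ∀ π {i j} → bit π + i * 2 ≡ bit π + j * 2 → i ≡ j
offset-injective π {i} {j} eq = *-cancelʳ-≡ i j 2 (+-cancelˡ-≡ (bit π) _ _ eq)

inChain-≤ : ∀ π {i k} → i ≤ k → inChain π k (bit π + i * 2) ≡ true
inChain-≤ false {zero} _ = refl
inChain-≤ true {zero} _ = refl
inChain-≤ π {suc i} {suc k} (s≤s i≤k) rewrite bit+2 π i = inChain-≤ π i≤k

inChain⇒ : ∀ π k q → inChain π k q ≡ true → Σ ℕ λ i → q ≡ bit π + i * 2 × i ≤ k
inChain⇒ false k zero _ = 0 , refl , z≤n
inChain⇒ true k (suc zero) _ = 0 , refl , z≤n
inChain⇒ π (suc k) (suc (suc q)) on with inChain⇒ π k q on
... | i , refl , i≤k = suc i , sym (bit+2 π i) , s≤s i≤k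

inChain⇒onChain : ∀ π k q → inChain π k q ≡ true → onChain π q ≡ true
inChain⇒onChain π k q on with inChain⇒ π k q on
... | i , refl , _ = onChain-bit π i

inChain-above : ∀ π k q → bit π + k * 2 < q → inChain π k q ≡ false
inChain-above π k q top<q with inChain π k q in on
... | false = refl
... | true with inChain⇒ π k q on
...   | i , refl , i≤k = contradiction (+-monoʳ-≤ (bit π) (*-monoˡ-≤ 2 i≤k)) (<⇒≱ top<q)

inChain-below : ∀ π k q → q < bit π + suc k * 2 → inChain π k q ≡ onChain π q
inChain-below π k zero _ = refl
inChain-below π k (suc zero) _ = refl
inChain-below false zero (suc (suc q)) (s≤s (s≤s ()))
inChain-below true zero (suc (suc zero)) _ = refl
inChain-below true zero (suc (suc (suc q))) (s≤s (s≤s (s≤s ())))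
inChain-below π (suc k) (suc (suc q)) q<top rewrite bit+2 π (suc k) =
  inChain-below π k q (≤-pred (≤-pred q<top))

inChain-off : ∀ π k q → onChain π q ≡ false → inChain π k q ≡ false
inChain-off π k q off with inChain π k q in on
... | false = refl
... | true = contradiction (trans (sym (inChain⇒onChain π k q on)) off) true≢false

data Chain : Set where
  none : Chain
  chain : Bool → ℕ → Chain

chainHas : Chain → ℕ → Bool
chainHas none _ = false
chainHas (chain π k) = inChain π k

-- The part of the infinite π-chain strictly below the offset bit π + k * 2.
chain-before : Bool → ℕ → Chain
chain-before π zero = none
chain-before π (suc k) = chain π k

chain-before-below : ∀ π k r → r < bit π + k * 2 → chainHas (chain-before π k) r ≡ onChain π r
chain-before-below true zero zero _ = refl
chain-before-below true zero (suc r) (s≤s ())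
chain-before-below π (suc k) r r<top = inChain-below π k r r<top

chain-before-above : ∀ π k r → bit π + k * 2 ≤ r → chainHas (chain-before π k) r ≡ false
chain-before-above π zero r _ = refl
chain-before-above π (suc k) r top≤r = inChain-above π k r (≤-trans (n≤1+n _) (subst (_≤ r) (bit+2 π k) top≤r))

record Code : Set where
  constructor code
  field
    has₁ has₂ : Bool
    tail : Chain
open Code

⟦_⟧ : Code → ℕ → Bool
⟦ code b₁ _ _ ⟧ zero = b₁
⟦ code _ b₂ _ ⟧ (suc zero) = b₂
⟦ code _ _ c ⟧ (suc (suc q)) = chainHas c q

⟦chain⟧-above : ∀ b₁ b₂ π k r → 2 + (bit π + k * 2) < r → ⟦ code b₁ b₂ (chain π k) ⟧ r ≡ false
⟦chain⟧-above _ _ π k (suc (suc r)) (s≤s (s≤s top<r)) = inChain-above π k r top<r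

-- The codes of the members of T_1, T_2, …: an odd chain comes with at most one of
-- the elements 1, 2 and an even chain with at least one of them.
Valid : Code → Set
Valid (code _ _ none) = ⊤
Valid (code b₁ b₂ (chain false _)) = b₁ ∧ b₂ ≡ false
Valid (code b₁ b₂ (chain true _)) = b₁ ∨ b₂ ≡ true

infix 4 _≼_ _⊑ₚ_ _⊑_

_≼_ : Chain → Chain → Set
none ≼ _ = ⊤
chain _ _ ≼ none = ⊥
chain π k ≼ chain ρ l = π ≡ ρ × k ≤ l

_≼?_ : ∀ x y → Dec (x ≼ y)
none ≼? _ = yes tt
chain _ _ ≼? none = no λ ()
chain π k ≼? chain ρ l = (π Bool.≟ ρ) ×-dec (k ≤? l)

ChainDisjoint : Chain → Chain → Set
ChainDisjoint none _ = ⊤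
ChainDisjoint (chain _ _) none = ⊤
ChainDisjoint (chain π _) (chain ρ _) = π ≢ ρ

record _⊑ₚ_ (x y : Code) : Set where
  constructor bits
  field
    bit₁ : has₁ x Bool.≤ has₁ y
    bit₂ : has₂ x Bool.≤ has₂ y

record _⊑_ (x y : Code) : Set where
  constructor sub
  field
    prefix : x ⊑ₚ y
    tail≼ : tail x ≼ tail y
open _⊑_

Comparable : Code → Code → Set
Comparable x y = x ⊑ y ⊎ y ⊑ x

record Disjoint (x y : Code) : Set where
  constructor disjoint
  field
    disjoint₁ : has₁ x ∧ has₁ y ≡ false
    disjoint₂ : has₂ x ∧ has₂ y ≡ false
    disjointTail : ChainDisjoint (tail x) (tail y)
open Disjoint

data Full : Code → Set where
  full : ∀ {c} → Full (code true true c)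

data Empty : Code → Set where
  empty : ∀ {c} → Empty (code false false c)

data EmptyOdd : Code → Set where
  emptyOdd : ∀ {k} → EmptyOdd (code false false (chain false k))

_⊑ₚ?_ : ∀ x y → Dec (x ⊑ₚ y)
x ⊑ₚ? y with has₁ x Boolₚ.≤? has₁ y | has₂ x Boolₚ.≤? has₂ y
... | yes ≤₁ | yes ≤₂ = yes (bits ≤₁ ≤₂)
... | no ≰₁ | _ = no (≰₁ ∘ _⊑ₚ_.bit₁)
... | yes _ | no ≰₂ = no (≰₂ ∘ _⊑ₚ_.bit₂)

Comparable-sym : ∀ {x y} → Comparable x y → Comparable y x
Comparable-sym = Sum.swap

Disjoint-sym : ∀ {x y} → Disjoint x y → Disjoint y x
Disjoint-sym {code a₁ a₂ x} {code b₁ b₂ y} (disjoint d₁ d₂ dc) =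
  disjoint (trans (Boolₚ.∧-comm b₁ a₁) d₁) (trans (Boolₚ.∧-comm b₂ a₂) d₂) (chain-sym x y dc)
  where
  chain-sym : ∀ x y → ChainDisjoint x y → ChainDisjoint y x
  chain-sym none none _ = tt
  chain-sym none (chain _ _) _ = tt
  chain-sym (chain _ _) none _ = tt
  chain-sym (chain _ _) (chain _ _) π≢ρ = π≢ρ ∘ sym

incomparable-prefixes-cover : ∀ {a b} → ¬ a ⊑ₚ b → ¬ b ⊑ₚ a →
                              has₁ a ∨ has₁ b ≡ true × has₂ a ∨ has₂ b ≡ true
incomparable-prefixes-cover {code a₁ a₂ _} {code b₁ b₂ _} a⋢b b⋢a =
  first a₁ b₁ (λ ≤₁ ≤₂ → a⋢b (bits ≤₁ ≤₂)) (λ ≤₁ ≤₂ → b⋢a (bits ≤₁ ≤₂)) ,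
  first a₂ b₂ (λ ≤₂ ≤₁ → a⋢b (bits ≤₁ ≤₂)) (λ ≤₂ ≤₁ → b⋢a (bits ≤₁ ≤₂))
  where
  first : ∀ a₁ b₁ {a₂ b₂} → (a₁ Bool.≤ b₁ → a₂ Bool.≤ b₂ → ⊥) → (b₁ Bool.≤ a₁ → b₂ Bool.≤ a₂ → ⊥) →
          a₁ ∨ b₁ ≡ true
  first true _ _ _ = refl
  first false true _ _ = refl
  first false false {a₂} {b₂} a≰b b≰a with Boolₚ.≤-total a₂ b₂
  ... | inj₁ a₂≤b₂ = ⊥-elim (a≰b Bool.b≤b a₂≤b₂)
  ... | inj₂ b₂≤a₂ = ⊥-elim (b≰a Bool.b≤b b₂≤a₂)

covered-bound : ∀ {a b c} → a Bool.≤ c → b Bool.≤ c → a ∨ b ≡ true → c ≡ true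
covered-bound {true} Bool.b≤b _ _ = refl
covered-bound {false} {true} _ Bool.b≤b _ = refl

covered-disjoint : ∀ {a b z} → a ∧ z ≡ false → b ∧ z ≡ false → a ∨ b ≡ true → z ≡ false
covered-disjoint {true} az _ _ = az
covered-disjoint {false} {true} _ bz _ = bz

covering-bound : ∀ {a b c} → ¬ a ⊑ₚ b → ¬ b ⊑ₚ a → a ⊑ₚ c → b ⊑ₚ c → Full c
covering-bound {c = code _ _ _} a⋢b b⋢a (bits a₁≤c₁ a₂≤c₂) (bits b₁≤c₁ b₂≤c₂)
  with incomparable-prefixes-cover a⋢b b⋢a
... | cover₁ , cover₂ with covered-bound a₁≤c₁ b₁≤c₁ cover₁ | covered-bound a₂≤c₂ b₂≤c₂ cover₂
...   | refl | refl = full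

covering-disjoint : ∀ {a b z} → ¬ a ⊑ₚ b → ¬ b ⊑ₚ a → Disjoint a z → Disjoint b z → Empty z
covering-disjoint {z = code z₁ z₂ _} a⋢b b⋢a az bz with incomparable-prefixes-cover a⋢b b⋢a
... | cover₁ , cover₂ with covered-disjoint {z = z₁} (disjoint₁ az) (disjoint₁ bz) cover₁
                          | covered-disjoint {z = z₂} (disjoint₂ az) (disjoint₂ bz) cover₂
...   | refl | refl = empty

full-above : ∀ {b c} → Full b → b ⊑ₚ c → Full c
full-above full (bits Bool.b≤b Bool.b≤b) = full

full-disjoint : ∀ {b z} → Full b → Disjoint b z → Empty z
full-disjoint {z = code _ _ _} full (disjoint refl refl _) = empty

data StrictPrefix (a b : Code) : Set where
  below-full : Full b → StrictPrefix a b
  empty-below-single : Empty a → has₁ b ≢ has₂ b → StrictPrefix a b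

strict-prefix : ∀ {a b} → a ⊑ₚ b → ¬ b ⊑ₚ a → StrictPrefix a b
strict-prefix {code _ _ _} {code _ _ _} (bits Bool.f≤t Bool.f≤t) _ = below-full full
strict-prefix {code _ true _} {code _ _ _} (bits Bool.f≤t Bool.b≤b) _ = below-full full
strict-prefix {code _ false _} {code _ _ _} (bits Bool.f≤t Bool.b≤b) _ = empty-below-single empty λ ()
strict-prefix {code true _ _} {code _ _ _} (bits Bool.b≤b Bool.f≤t) _ = below-full full
strict-prefix {code false _ _} {code _ _ _} (bits Bool.b≤b Bool.f≤t) _ = empty-below-single empty λ ()
strict-prefix (bits Bool.b≤b Bool.b≤b) b⋢a = contradiction (bits Bool.b≤b Bool.b≤b) b⋢a

single-prefix-bound : ∀ {b c} → has₁ b ≢ has₂ b → b ⊑ₚ c → has₁ c ∧ has₂ c ≡ false →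
                      has₁ c ≡ has₁ b × has₂ c ≡ has₂ b
single-prefix-bound {code true true _} b₁≢b₂ _ _ = contradiction refl b₁≢b₂
single-prefix-bound {code false false _} b₁≢b₂ _ _ = contradiction refl b₁≢b₂
single-prefix-bound {code true false _} {code .true false _} _ (bits Bool.b≤b _) _ = refl , refl
single-prefix-bound {code false true _} {code false .true _} _ (bits _ Bool.b≤b) _ = refl , refl

≼-lower-comparable : ∀ {x y z} → x ≼ z → y ≼ z → x ≼ y ⊎ y ≼ x
≼-lower-comparable {none} _ _ = inj₁ tt
≼-lower-comparable {chain _ _} {none} _ _ = inj₂ tt
≼-lower-comparable {chain _ k} {chain _ l} {chain _ _} (refl , _) (refl , _) with ≤-total k l
... | inj₁ k≤l = inj₁ (refl , k≤l)
... | inj₂ l≤k = inj₂ (refl , l≤k)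

above-chain : ∀ {π k y} → chain π k ≼ y → Σ ℕ λ l → y ≡ chain π l
above-chain {y = chain _ l} (refl , _) = l , refl

data OnParity (π : Bool) : Chain → Set where
  none : OnParity π none
  chain : ∀ {k} → OnParity π (chain π k)

OnParity-comparable : ∀ {π x y} → OnParity π x → OnParity π y → x ≼ y ⊎ y ≼ x
OnParity-comparable none _ = inj₁ tt
OnParity-comparable chain none = inj₂ tt
OnParity-comparable (chain {k}) (chain {l}) with ≤-total k l
... | inj₁ k≤l = inj₁ (refl , k≤l)
... | inj₂ l≤k = inj₂ (refl , l≤k)

OnParity-disjoint : ∀ {x y} → OnParity true x → OnParity false y → ChainDisjoint x y
OnParity-disjoint none _ = tt
OnParity-disjoint chain none = tt
OnParity-disjoint chain chain = λ ()

full-parity : ∀ {c} → Full c → Valid c → OnParity true (tail c)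
full-parity {code _ _ none} full _ = none
full-parity {code _ _ (chain true _)} full _ = chain

empty-parity : ∀ {c} → Empty c → Valid c → OnParity false (tail c)
empty-parity {code _ _ none} empty _ = none
empty-parity {code _ _ (chain false _)} empty _ = chain

empty-odd-tail : ∀ {x y} → Empty x → Valid x → ¬ tail x ≼ y → EmptyOdd x
empty-odd-tail {code _ _ none} empty _ x⋠y = contradiction tt x⋠y
empty-odd-tail {code _ _ (chain false _)} empty _ _ = emptyOdd

incomparable-chains-disjoint : ∀ {x y w} → ¬ x ≼ y → ¬ y ≼ x →
                               ChainDisjoint x w → ChainDisjoint y w → w ≡ none
incomparable-chains-disjoint {none} x⋠y _ _ _ = contradiction tt x⋠y
incomparable-chains-disjoint {chain _ _} {none} _ y⋠x _ _ = contradiction tt y⋠x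
incomparable-chains-disjoint {chain _ _} {chain _ _} {none} _ _ _ _ = refl
incomparable-chains-disjoint {chain π k} {chain ρ l} {chain σ _} x⋠y y⋠x π≢σ ρ≢σ with π Bool.≟ ρ
... | no π≢ρ = ⊥-elim (three-booleans π≢ρ π≢σ ρ≢σ)
  where
  three-booleans : ∀ {π ρ σ} → π ≢ ρ → π ≢ σ → ρ ≢ σ → ⊥
  three-booleans {false} {false} π≢ρ _ _ = π≢ρ refl
  three-booleans {true} {true} π≢ρ _ _ = π≢ρ refl
  three-booleans {false} {true} {false} _ π≢σ _ = π≢σ refl
  three-booleans {false} {true} {true} _ _ ρ≢σ = ρ≢σ refl
  three-booleans {true} {false} {true} _ π≢σ _ = π≢σ refl
  three-booleans {true} {false} {false} _ _ ρ≢σ = ρ≢σ refl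
... | yes refl with ≤-total k l
...   | inj₁ k≤l = contradiction (refl , k≤l) x⋠y
...   | inj₂ l≤k = contradiction (refl , l≤k) y⋠x

same-prefix-comparable : ∀ {b₁ b₂ x y} → x ≼ y ⊎ y ≼ x → Comparable (code b₁ b₂ x) (code b₁ b₂ y)
same-prefix-comparable (inj₁ x≼y) = inj₁ (sub (bits Bool.b≤b Bool.b≤b) x≼y)
same-prefix-comparable (inj₂ y≼x) = inj₂ (sub (bits Bool.b≤b Bool.b≤b) y≼x)

full-comparable : ∀ {c d} → Full c → Full d → Valid c → Valid d → Comparable c d
full-comparable full full vc vd = same-prefix-comparable (OnParity-comparable (full-parity full vc) (full-parity full vd))

empty-comparable : ∀ {c d} → Empty c → Empty d → Valid c → Valid d → Comparable c d
empty-comparable empty empty vc vd = same-prefix-comparable (OnParity-comparable (empty-parity empty vc) (empty-parity empty vd))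

full-empty-disjoint : ∀ {c z} → Full c → Empty z → Valid c → Valid z → Disjoint c z
full-empty-disjoint full empty vc vz = disjoint refl refl (OnParity-disjoint (full-parity full vc) (empty-parity empty vz))

EmptyOdd-not-disjoint : ∀ {x y} → EmptyOdd x → EmptyOdd y → ¬ Disjoint x y
EmptyOdd-not-disjoint emptyOdd emptyOdd (disjoint _ _ false≢false) = false≢false refl

-- No induced butterfly among codes

-- The shape of a common upper bound c of incomparable codes a, b with a ⊑ₚ b.
data OrderedBound (a b c : Code) : Set where
  full-bound : Full b → OrderedBound a b c
  odd-bound : ∀ {k} → EmptyOdd a → has₁ b ≢ has₂ b → tail c ≡ chain false k →
              has₁ c ≡ has₁ b → has₂ c ≡ has₂ b → OrderedBound a b c

ordered-bound : ∀ {a b c} → Valid a → Valid c → a ⊑ₚ b → ¬ Comparable a b → a ⊑ c → b ⊑ c →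
                OrderedBound a b c
ordered-bound {c = code _ _ _} va vc a⊑ₚb a∥b (sub _ ta≼tc) (sub b⊑ₚc tb≼tc)
  with ≼-lower-comparable ta≼tc tb≼tc
... | inj₁ ta≼tb = contradiction (inj₁ (sub a⊑ₚb ta≼tb)) a∥b
... | inj₂ tb≼ta with strict-prefix a⊑ₚb (λ b⊑ₚa → a∥b (inj₂ (sub b⊑ₚa tb≼ta)))
...   | below-full b-full = full-bound b-full
...   | empty-below-single a-empty b-single
  with empty-odd-tail a-empty va (λ ta≼tb → a∥b (inj₁ (sub a⊑ₚb ta≼tb)))
...     | emptyOdd with above-chain ta≼tc
...       | _ , refl with single-prefix-bound b-single b⊑ₚc vc
...         | c₁≡b₁ , c₂≡b₂ = odd-bound emptyOdd b-single refl c₁≡b₁ c₂≡b₂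

prefix-equal-comparable : ∀ {c d} → has₁ c ≡ has₁ d → has₂ c ≡ has₂ d → tail c ≼ tail d ⊎ tail d ≼ tail c →
                          Comparable c d
prefix-equal-comparable {code _ _ _} {code _ _ _} refl refl = same-prefix-comparable

ordered-bounds-comparable : ∀ {a b c d} → Valid a → Valid c → Valid d → a ⊑ₚ b → ¬ Comparable a b →
                            a ⊑ c → b ⊑ c → a ⊑ d → b ⊑ d → Comparable c d
ordered-bounds-comparable {c = code _ _ _} {code _ _ _} va vc vd a⊑ₚb a∥b a⊑c b⊑c a⊑d b⊑d
  with ordered-bound va vc a⊑ₚb a∥b a⊑c b⊑c | ordered-bound va vd a⊑ₚb a∥b a⊑d b⊑d
... | full-bound b-full | _ = full-comparable (full-above b-full (prefix b⊑c)) (full-above b-full (prefix b⊑d)) vc vd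
... | odd-bound _ b-single _ _ _ | full-bound full = contradiction refl b-single
... | odd-bound _ _ refl c₁ c₂ | odd-bound _ _ refl d₁ d₂ =
  prefix-equal-comparable (trans c₁ (sym d₁)) (trans c₂ (sym d₂)) (OnParity-comparable chain chain)

upper-bounds-comparable : ∀ {a b c d} → Valid a → Valid b → Valid c → Valid d →
                          a ⊑ c → b ⊑ c → a ⊑ d → b ⊑ d → ¬ Comparable a b → Comparable c d
upper-bounds-comparable {a} {b} va vb vc vd a⊑c b⊑c a⊑d b⊑d a∥b with a ⊑ₚ? b | b ⊑ₚ? a
... | yes a⊑ₚb | _ = ordered-bounds-comparable va vc vd a⊑ₚb a∥b a⊑c b⊑c a⊑d b⊑d
... | no _ | yes b⊑ₚa = ordered-bounds-comparable vb vc vd b⊑ₚa (a∥b ∘ Comparable-sym) b⊑c a⊑c b⊑d a⊑d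
... | no a⋢ₚb | no b⋢ₚa = full-comparable
  (covering-bound a⋢ₚb b⋢ₚa (prefix a⊑c) (prefix b⊑c))
  (covering-bound a⋢ₚb b⋢ₚa (prefix a⊑d) (prefix b⊑d)) vc vd

ordered-bound-disjoint : ∀ {a b c z} → Valid a → Valid c → Valid z → a ⊑ₚ b → ¬ Comparable a b →
                         a ⊑ c → b ⊑ c → Disjoint a z → Disjoint b z → Disjoint c z
ordered-bound-disjoint {c = code _ _ _} {z} va vc vz a⊑ₚb a∥b a⊑c b⊑c az bz
  with ordered-bound va vc a⊑ₚb a∥b a⊑c b⊑c
... | full-bound b-full = full-empty-disjoint (full-above b-full (prefix b⊑c)) (full-disjoint b-full bz) vc vz
... | odd-bound emptyOdd _ refl refl refl = disjoint (disjoint₁ bz) (disjoint₂ bz) (odd-disjoint (tail z) (disjointTail az))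
  where
  odd-disjoint : ∀ {k l} y → ChainDisjoint (chain false k) y → ChainDisjoint (chain false l) y
  odd-disjoint none _ = tt
  odd-disjoint (chain _ _) false≢ρ = false≢ρ

upper-bound-disjoint : ∀ {a b c z} → Valid a → Valid b → Valid c → Valid z →
                       a ⊑ c → b ⊑ c → Disjoint a z → Disjoint b z → ¬ Comparable a b → Disjoint c z
upper-bound-disjoint {a} {b} va vb vc vz a⊑c b⊑c az bz a∥b with a ⊑ₚ? b | b ⊑ₚ? a
... | yes a⊑ₚb | _ = ordered-bound-disjoint va vc vz a⊑ₚb a∥b a⊑c b⊑c az bz
... | no _ | yes b⊑ₚa = ordered-bound-disjoint vb vc vz b⊑ₚa (a∥b ∘ Comparable-sym) b⊑c a⊑c bz az
... | no a⋢ₚb | no b⋢ₚa = full-empty-disjoint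
  (covering-bound a⋢ₚb b⋢ₚa (prefix a⊑c) (prefix b⊑c)) (covering-disjoint a⋢ₚb b⋢ₚa az bz) vc vz

module _ {y z : Code} (vy : Valid y) (vz : Valid z) (y∥z : ¬ Comparable y z) where

  oriented-empty-odd : ∀ {a b} → Valid b → ¬ Comparable a b → tail a ≼ tail b →
                       Disjoint a y → Disjoint a z → Disjoint b y → Disjoint b z → EmptyOdd b
  oriented-empty-odd {a} {b} vb a∥b ta≼tb ay az by bz with b ⊑ₚ? a
  ... | no b⋢ₚa = contradiction
        (empty-comparable (covering-disjoint a⋢ₚb b⋢ₚa ay by) (covering-disjoint a⋢ₚb b⋢ₚa az bz) vy vz) y∥z
    where a⋢ₚb = λ a⊑ₚb → a∥b (inj₁ (sub a⊑ₚb ta≼tb))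
  ... | yes b⊑ₚa with strict-prefix b⊑ₚa (λ a⊑ₚb → a∥b (inj₁ (sub a⊑ₚb ta≼tb)))
  ...   | below-full a-full = contradiction (empty-comparable (full-disjoint a-full ay) (full-disjoint a-full az) vy vz) y∥z
  ...   | empty-below-single b-empty _ = empty-odd-tail b-empty vb (λ tb≼ta → a∥b (inj₂ (sub b⊑ₚa tb≼ta)))

  incomparable-has-empty-odd : ∀ {a b} → Valid a → Valid b → ¬ Comparable a b →
                               Disjoint a y → Disjoint a z → Disjoint b y → Disjoint b z → EmptyOdd a ⊎ EmptyOdd b
  incomparable-has-empty-odd {a} {b} va vb a∥b ay az by bz with tail a ≼? tail b | tail b ≼? tail a
  ... | yes ta≼tb | _ = inj₂ (oriented-empty-odd vb a∥b ta≼tb ay az by bz)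
  ... | no _ | yes tb≼ta = inj₁ (oriented-empty-odd va (a∥b ∘ Comparable-sym) tb≼ta by bz ay az)
  ... | no ta⋠tb | no tb⋠ta = contradiction (empty-comparable
        (covering-disjoint y⋢ₚz z⋢ₚy (Disjoint-sym ay) (Disjoint-sym az))
        (covering-disjoint y⋢ₚz z⋢ₚy (Disjoint-sym by) (Disjoint-sym bz)) va vb) a∥b
    where
    y⋢ₚz : ¬ y ⊑ₚ z
    y⋢ₚz y⊑ₚz = y∥z (inj₁ (sub y⊑ₚz (subst (_≼ tail z) (sym ty≡none) tt)))
      where ty≡none = incomparable-chains-disjoint ta⋠tb tb⋠ta (disjointTail ay) (disjointTail by)
    z⋢ₚy : ¬ z ⊑ₚ y
    z⋢ₚy z⊑ₚy = y∥z (inj₂ (sub z⊑ₚy (subst (_≼ tail y) (sym tz≡none) tt)))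
      where tz≡none = incomparable-chains-disjoint ta⋠tb tb⋠ta (disjointTail az) (disjointTail bz)

disjoint-incomparable-pairs : ∀ {a b y z} → Valid a → Valid b → Valid y → Valid z →
                              ¬ Comparable a b → ¬ Comparable y z →
                              Disjoint a y → Disjoint a z → Disjoint b y → Disjoint b z → ⊥
disjoint-incomparable-pairs va vb vy vz a∥b y∥z ay az by bz
  with incomparable-has-empty-odd vy vz y∥z va vb a∥b ay az by bz
     | incomparable-has-empty-odd va vb a∥b vy vz y∥z (Disjoint-sym ay) (Disjoint-sym by) (Disjoint-sym az) (Disjoint-sym bz)
... | inj₁ a-odd | inj₁ y-odd = EmptyOdd-not-disjoint a-odd y-odd ay
... | inj₁ a-odd | inj₂ z-odd = EmptyOdd-not-disjoint a-odd z-odd az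
... | inj₂ b-odd | inj₁ y-odd = EmptyOdd-not-disjoint b-odd y-odd by
... | inj₂ b-odd | inj₂ z-odd = EmptyOdd-not-disjoint b-odd z-odd bz

-- The members of H_n

infix 10 ⟪_⟫_

⟪_⟫_ : Code → (n : ℕ) → Subset n
⟪ c ⟫ n = tabulate (λ i → ⟦ c ⟧ (toℕ i))

-- The set lies inside [n - 1], i.e. it avoids the last element n.
FitsIn : ℕ → Code → Set
FitsIn n c = ∀ p → ⟦ c ⟧ p ≡ true → suc p < n

!-⟪⟫ : ∀ c {n} p → p < n → ⟪ c ⟫ n ! p ≡ ⟦ c ⟧ p
!-⟪⟫ c p = !-tabulate ⟦ c ⟧

!-⟪⟫-∁ : ∀ c {n} p → p < n → ∁ (⟪ c ⟫ n) ! p ≡ not (⟦ c ⟧ p)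
!-⟪⟫-∁ c {n} p p<n = trans (!-∁ (⟪ c ⟫ n) p<n) (cong not (!-⟪⟫ c p p<n))

⟪⟫-true : ∀ c {n} p → FitsIn n c → ⟦ c ⟧ p ≡ true → ⟪ c ⟫ n ! p ≡ true
⟪⟫-true c p fits cp = trans (!-⟪⟫ c p (<⇒≤ (fits p cp))) cp

⟪⟫-false : ∀ c {n} p → ⟦ c ⟧ p ≡ false → ⟪ c ⟫ n ! p ≡ false
⟪⟫-false c {n} p cp with p <? n
... | yes p<n = trans (!-⟪⟫ c p p<n) cp
... | no p≮n = !-≥ (⟪ c ⟫ n) (≮⇒≥ p≮n)

!-⟪⟫-fits : ∀ c {n} p → FitsIn n c → ⟪ c ⟫ n ! p ≡ ⟦ c ⟧ p
!-⟪⟫-fits c {n} p fits with ⟦ c ⟧ p in cp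
... | true = ⟪⟫-true c p fits cp
... | false = ⟪⟫-false c {n} p cp

⟪⟫-true⇒ : ∀ c {n} p → ⟪ c ⟫ n ! p ≡ true → ⟦ c ⟧ p ≡ true
⟪⟫-true⇒ c {n} p sp = trans (sym (!-⟪⟫ c p (!⇒< (⟪ c ⟫ n) sp))) sp

⟪⟫-last : ∀ c {m} → FitsIn (suc m) c → ⟪ c ⟫ (suc m) ! m ≡ false
⟪⟫-last c {m} fits with ⟪ c ⟫ (suc m) ! m in sm
... | false = refl
... | true = contradiction (fits m (⟪⟫-true⇒ c {suc m} m sm)) (<-irrefl refl)

⊑-pointwise : ∀ {c d} p → c ⊑ d → ⟦ c ⟧ p ≡ true → ⟦ d ⟧ p ≡ true
⊑-pointwise {code _ _ _} {code _ _ _} zero (sub (bits Bool.b≤b _) _) c₁ = c₁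
⊑-pointwise {code _ _ _} {code _ _ _} (suc zero) (sub (bits _ Bool.b≤b) _) c₂ = c₂
⊑-pointwise {code _ _ (chain π k)} {code _ _ (chain .π l)} (suc (suc q)) (sub _ (refl , k≤l)) cq
  with inChain⇒ π k q cq
... | i , refl , i≤k = inChain-≤ π (≤-trans i≤k k≤l)

Disjoint-pointwise : ∀ {c d} p → Disjoint c d → ⟦ c ⟧ p ≡ true → ⟦ d ⟧ p ≡ false
Disjoint-pointwise {code true _ _} {code _ _ _} zero (disjoint d₁ _ _) _ = d₁
Disjoint-pointwise {code _ true _} {code _ _ _} (suc zero) (disjoint _ d₂ _) _ = d₂
Disjoint-pointwise {code _ _ (chain π k)} {code _ _ none} (suc (suc q)) _ _ = refl
Disjoint-pointwise {code _ _ (chain π k)} {code _ _ (chain ρ l)} (suc (suc q)) (disjoint _ _ π≢ρ) cq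
  with inChain ρ l q in dq
... | false = refl
... | true = contradiction (trans (parity π k cq) (sym (parity ρ l dq))) π≢ρ
  where
  parity : ∀ π k → inChain π k q ≡ true → π ≡ onChain true q
  parity π k cq = onChain⇒parity π q (inChain⇒onChain π k q cq)

⇒-≤ : ∀ {a b} → (a ≡ true → b ≡ true) → a Bool.≤ b
⇒-≤ {false} {false} _ = Bool.b≤b
⇒-≤ {false} {true} _ = Bool.f≤t
⇒-≤ {true} {true} _ = Bool.b≤b
⇒-≤ {true} {false} a⇒b = contradiction (a⇒b refl) λ ()

⇒-∧ : ∀ {a b} → (a ≡ true → b ≡ false) → a ∧ b ≡ false
⇒-∧ {false} _ = refl
⇒-∧ {true} a⇒¬b = a⇒¬b refl

pointwise-⊑ : ∀ {c d} → (∀ p → ⟦ c ⟧ p ≡ true → ⟦ d ⟧ p ≡ true) → c ⊑ d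
pointwise-⊑ {code _ _ tc} {code _ _ td} c⊆d =
  sub (bits (⇒-≤ (c⊆d 0)) (⇒-≤ (c⊆d 1))) (tails tc td (c⊆d ∘ suc ∘ suc))
  where
  tails : ∀ x y → (∀ q → chainHas x q ≡ true → chainHas y q ≡ true) → x ≼ y
  tails none _ _ = tt
  tails (chain π k) none x⊆y = contradiction (x⊆y (bit π + k * 2) (inChain-≤ π {k} ≤-refl)) λ ()
  tails (chain π k) (chain ρ l) x⊆y
    with inChain⇒ ρ l (bit π + k * 2) (x⊆y (bit π + k * 2) (inChain-≤ π {k} ≤-refl))
  ... | i , top≡ , i≤l
    with trans (onChain⇒parity ρ (bit π + k * 2) (subst (λ q → onChain ρ q ≡ true) (sym top≡) (onChain-bit ρ i)))
               (sym (onChain⇒parity π (bit π + k * 2) (onChain-bit π k)))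
  ...   | refl = refl , subst (_≤ l) (sym (offset-injective π top≡)) i≤l

pointwise-Disjoint : ∀ {c d} → (∀ p → ⟦ c ⟧ p ≡ true → ⟦ d ⟧ p ≡ false) → Disjoint c d
pointwise-Disjoint {code _ _ tc} {code _ _ td} c∩d =
  disjoint (⇒-∧ (c∩d 0)) (⇒-∧ (c∩d 1)) (tails tc td (c∩d ∘ suc ∘ suc))
  where
  tails : ∀ x y → (∀ q → chainHas x q ≡ true → chainHas y q ≡ false) → ChainDisjoint x y
  tails none _ _ = tt
  tails (chain _ _) none _ = tt
  tails (chain π k) (chain .π l) x∩y refl =
    contradiction (trans (sym (inChain-≤ π {0} {l} z≤n)) (x∩y (bit π + 0 * 2) (inChain-≤ π {0} {k} z≤n))) λ ()

⊑⇒⊆ : ∀ {n c d} → c ⊑ d → ⟪ c ⟫ n ⊆! ⟪ d ⟫ n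
⊑⇒⊆ {n} {c} {d} c⊑d = ⊆!⁺ λ p cp →
  trans (!-⟪⟫ d p (!⇒< (⟪ c ⟫ n) cp)) (⊑-pointwise p c⊑d (⟪⟫-true⇒ c {n} p cp))

⊆⇒⊑ : ∀ {n c d} → FitsIn n c → ⟪ c ⟫ n ⊆! ⟪ d ⟫ n → c ⊑ d
⊆⇒⊑ {n} {c} {d} fits c⊆d = pointwise-⊑ (λ p cp → ⟪⟫-true⇒ d {n} p (⊆!⁻ c⊆d p (⟪⟫-true c p fits cp)))

Disjoint⇒⊆∁ : ∀ {n c d} → Disjoint c d → ⟪ c ⟫ n ⊆! ∁ (⟪ d ⟫ n)
Disjoint⇒⊆∁ {n} {c} {d} c∩d = ⊆!⁺ λ p cp →
  trans (!-⟪⟫-∁ d p (!⇒< (⟪ c ⟫ n) cp)) (cong not (Disjoint-pointwise p c∩d (⟪⟫-true⇒ c {n} p cp)))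

⊆∁⇒Disjoint : ∀ {n c d} → FitsIn n c → ⟪ c ⟫ n ⊆! ∁ (⟪ d ⟫ n) → Disjoint c d
⊆∁⇒Disjoint {c = c} {d} fits c⊆∁d = pointwise-Disjoint λ p cp →
  trans (sym (Boolₚ.not-involutive _))
        (cong not (trans (sym (!-⟪⟫-∁ d p (<⇒≤ (fits p cp)))) (⊆!⁻ c⊆∁d p (⟪⟫-true c p fits cp))))

∁⟪⟫⊈⟪⟫ : ∀ {m} c d → FitsIn (suc m) c → FitsIn (suc m) d → ¬ ∁ (⟪ c ⟫ (suc m)) ⊆! ⟪ d ⟫ (suc m)
∁⟪⟫⊈⟪⟫ {m} c d c-fits d-fits =
  ⊈-witness m (trans (!-∁ (⟪ c ⟫ (suc m)) ≤-refl) (cong not (⟪⟫-last c c-fits))) (⟪⟫-last d d-fits)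

prefixElems : Bool → Bool → List ℕ
prefixElems false false = []
prefixElems true false = 1 ∷ []
prefixElems false true = 2 ∷ []
prefixElems true true = 1 ∷ 2 ∷ []

chainElems : Chain → List ℕ
chainElems none = []
chainElems (chain false k) = odds (suc k)
chainElems (chain true k) = evens (suc (suc k))

elems : Code → List ℕ
elems (code b₁ b₂ c) = prefixElems b₁ b₂ ++ chainElems c

level : Code → ℕ
level (code _ _ (chain π k)) = 3 + (bit π + k * 2)
level (code false false none) = 1
level (code true _ none) = 2
level (code false true none) = 2

chainElems-offsets : ∀ π k → chainElems (chain π k) ≡ map (λ i → 3 + (bit π + i * 2)) (upTo (suc k))
chainElems-offsets false k = Listₚ.map-cong odd (upTo (suc k))
  where
  odd : ∀ i → 2 * (i + 1) + 1 ≡ 3 + i * 2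
  odd i = begin
    2 * (i + 1) + 1   ≡⟨ cong (_+ 1) (*-distribˡ-+ 2 i 1) ⟩
    2 * i + 2 + 1     ≡⟨ +-assoc (2 * i) 2 1 ⟩
    2 * i + 3         ≡⟨ +-comm (2 * i) 3 ⟩
    3 + 2 * i         ≡⟨ cong (3 +_) (*-comm 2 i) ⟩
    3 + i * 2         ∎
    where open ≡-Reasoning
chainElems-offsets true k = Listₚ.map-cong even (upTo (suc k))
  where
  even : ∀ i → 2 * (i + 2) ≡ 4 + i * 2
  even i = begin
    2 * (i + 2)   ≡⟨ *-distribˡ-+ 2 i 2 ⟩
    2 * i + 4     ≡⟨ +-comm (2 * i) 4 ⟩
    4 + 2 * i     ≡⟨ cong (4 +_) (*-comm 2 i) ⟩
    4 + i * 2     ∎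
    where open ≡-Reasoning

∈-chainElems : ∀ c {x} → x ∈ chainElems c → Σ ℕ λ q → x ≡ 3 + q × chainHas c q ≡ true
∈-chainElems (chain π k) {x} x∈
  with ∈-map⁻ (λ i → 3 + (bit π + i * 2)) {xs = upTo (suc k)} (subst (x ∈_) (chainElems-offsets π k) x∈)
... | i , i∈ , refl = bit π + i * 2 , refl , inChain-≤ π {i} (≤-pred (∈-upTo⁻ {suc k} i∈))

chainElems-∋ : ∀ c q → chainHas c q ≡ true → 3 + q ∈ chainElems c
chainElems-∋ (chain π k) q cq with inChain⇒ π k q cq
... | i , refl , i≤k = subst (3 + (bit π + i * 2) ∈_) (sym (chainElems-offsets π k))
                         (∈-map⁺ (λ i → 3 + (bit π + i * 2)) (∈-upTo⁺ (s≤s i≤k)))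

∈-prefixElems : ∀ b₁ b₂ {x} → x ∈ prefixElems b₁ b₂ → (x ≡ 1 × b₁ ≡ true) ⊎ (x ≡ 2 × b₂ ≡ true)
∈-prefixElems true false (here refl) = inj₁ (refl , refl)
∈-prefixElems false true (here refl) = inj₂ (refl , refl)
∈-prefixElems true true (here refl) = inj₁ (refl , refl)
∈-prefixElems true true (there (here refl)) = inj₂ (refl , refl)

∈-elems : ∀ c p → suc p ∈ elems c → ⟦ c ⟧ p ≡ true
∈-elems (code b₁ b₂ tc) p p+1∈ with ∈-++⁻ (prefixElems b₁ b₂) p+1∈
... | inj₁ p+1∈prefix with ∈-prefixElems b₁ b₂ p+1∈prefix
...   | inj₁ (refl , b₁≡true) = b₁≡true
...   | inj₂ (refl , b₂≡true) = b₂≡true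
∈-elems (code b₁ b₂ tc) p p+1∈ | inj₂ p+1∈chain with ∈-chainElems tc p+1∈chain
...   | q , refl , cq = cq

elems-∋ : ∀ c p → ⟦ c ⟧ p ≡ true → suc p ∈ elems c
elems-∋ (code true false _) zero _ = here refl
elems-∋ (code true true _) zero _ = here refl
elems-∋ (code false true _) (suc zero) _ = here refl
elems-∋ (code true true _) (suc zero) _ = there (here refl)
elems-∋ (code b₁ b₂ tc) (suc (suc q)) cq = ∈-++⁺ʳ (prefixElems b₁ b₂) (chainElems-∋ tc q cq)

any-≡ᵇ⇒∈ : ∀ xs {y} → any (λ x → x ≡ᵇ y) xs ≡ true → y ∈ xs
any-≡ᵇ⇒∈ xs {y} found =
  Any.map (λ {x} x≡ᵇy → sym (≡ᵇ⇒≡ x y x≡ᵇy)) (any⁻ _ xs (Equivalence.from Boolₚ.T-≡ found))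

∈⇒any-≡ᵇ : ∀ {xs y} → y ∈ xs → any (λ x → x ≡ᵇ y) xs ≡ true
∈⇒any-≡ᵇ {y = y} y∈xs = Equivalence.to Boolₚ.T-≡ (any⁺ _ (Any.map (λ { refl → ≡⇒≡ᵇ y y refl }) y∈xs))

fromElems-elems : ∀ n c → fromElems (elems c) ≡ ⟪ c ⟫ n
fromElems-elems n c = Vecₚ.tabulate-cong λ i → trans (if-true-false _) (Boolₚ.⇔→≡ (mk⇔
  (λ found → ∈-elems c (toℕ i) (any-≡ᵇ⇒∈ (elems c) found))
  (λ ci → ∈⇒any-≡ᵇ (elems-∋ c (toℕ i) ci))))
  where
  if-true-false : ∀ b → (if b then true else false) ≡ b
  if-true-false true = refl
  if-true-false false = refl

T-even : ∀ k → T (4 + k * 2) ≡ (1 ∷ evens (2 + k)) ∷ (2 ∷ evens (2 + k)) ∷ (1 ∷ 2 ∷ evens (2 + k)) ∷ []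
T-even k with (4 + k * 2) % 2 | [m+kn]%n≡m%n 4 k 2
... | .0 | refl = cong (λ h → (1 ∷ evens h) ∷ (2 ∷ evens h) ∷ (1 ∷ 2 ∷ evens h) ∷ []) (m*n/n≡m (2 + k) 2)

T-odd : ∀ k → T (5 + k * 2) ≡ odds (2 + k) ∷ (1 ∷ odds (2 + k)) ∷ (2 ∷ odds (2 + k)) ∷ []
T-odd k with (5 + k * 2) % 2 | [m+kn]%n≡m%n 5 k 2
... | .1 | refl = cong (λ h → odds h ∷ (1 ∷ odds h) ∷ (2 ∷ odds h) ∷ []) half
  where
  half : (5 + k * 2) / 2 ≡ 2 + k
  half = begin
    (1 + (2 + k) * 2) / 2
      ≡⟨ +-distrib-/ 1 ((2 + k) * 2) (subst (λ r → 1 + r < 2) (sym (m*n%n≡0 (2 + k) 2)) ≤-refl) ⟩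
    0 + (2 + k) * 2 / 2     ≡⟨ m*n/n≡m (2 + k) 2 ⟩
    2 + k                   ∎
    where open ≡-Reasoning

elems∈T : ∀ c → Valid c → elems c ∈ T (level c)
elems∈T (code false false none) _ = here refl
elems∈T (code true false none) _ = here refl
elems∈T (code false true none) _ = there (here refl)
elems∈T (code true true none) _ = there (there (here refl))
elems∈T (code false false (chain false zero)) _ = here refl
elems∈T (code true false (chain false zero)) _ = there (here refl)
elems∈T (code false true (chain false zero)) _ = there (there (here refl))
elems∈T (code false false (chain false (suc k))) _ rewrite T-odd k = here refl
elems∈T (code true false (chain false (suc k))) _ rewrite T-odd k = there (here refl)
elems∈T (code false true (chain false (suc k))) _ rewrite T-odd k = there (there (here refl))
elems∈T (code true false (chain true k)) _ rewrite T-even k = here refl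
elems∈T (code false true (chain true k)) _ rewrite T-even k = there (here refl)
elems∈T (code true true (chain true k)) _ rewrite T-even k = there (there (here refl))

CodeOfLevel : ℕ → List ℕ → Set
CodeOfLevel j t = Σ Code λ c → Valid c × level c ≡ j × t ≡ elems c

among : ∀ {j t} (cs : List Code) → All (λ c → Valid c × level c ≡ j) cs → t ∈ map elems cs → CodeOfLevel j t
among cs valid t∈ with ∈-map⁻ elems t∈
... | c , c∈cs , refl = c , All.lookup valid c∈cs .proj₁ , All.lookup valid c∈cs .proj₂ , refl

∈T⇒code : ∀ j {t} → t ∈ T j → CodeOfLevel j t
∈T⇒code 1 = among (code false false none ∷ []) ((tt , refl) ∷ [])
∈T⇒code 2 = among (code true false none ∷ code false true none ∷ code true true none ∷ [])
  ((tt , refl) ∷ (tt , refl) ∷ (tt , refl) ∷ [])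
∈T⇒code 3 = among
  (code false false (chain false 0) ∷ code true false (chain false 0) ∷ code false true (chain false 0) ∷ [])
  ((refl , refl) ∷ (refl , refl) ∷ (refl , refl) ∷ [])
∈T⇒code (suc (suc (suc (suc q)))) {t} t∈ with halve q | halve-inverse q
... | false , k | refl = among
  (code true false (chain true k) ∷ code false true (chain true k) ∷ code true true (chain true k) ∷ [])
  ((refl , refl) ∷ (refl , refl) ∷ (refl , refl) ∷ []) (subst (t ∈_) (T-even k) t∈)
... | true , k | refl = among
  (code false false (chain false (suc k)) ∷ code true false (chain false (suc k)) ∷
   code false true (chain false (suc k)) ∷ [])
  ((refl , refl) ∷ (refl , refl) ∷ (refl , refl) ∷ []) (subst (t ∈_) (T-odd k) t∈)

element<level : ∀ c p → ⟦ c ⟧ p ≡ true → p < level c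
element<level (code _ _ (chain π k)) zero _ = s≤s z≤n
element<level (code _ _ (chain π k)) (suc zero) _ = s≤s (s≤s z≤n)
element<level (code _ _ (chain π k)) (suc (suc q)) cq with inChain⇒ π k q cq
... | i , refl , i≤k = s≤s (s≤s (s≤s (+-monoʳ-≤ (bit π) (*-monoˡ-≤ 2 i≤k))))
element<level (code true false none) zero _ = s≤s z≤n
element<level (code true true none) zero _ = s≤s z≤n
element<level (code false true none) (suc zero) _ = ≤-refl
element<level (code true true none) (suc zero) _ = ≤-refl
element<level (code false _ none) zero ()
element<level (code _ false none) (suc zero) ()
element<level (code _ _ none) (suc (suc _)) ()

level<⇒fits : ∀ {n} c → level c < n → FitsIn n c
level<⇒fits c level<n p cp = <-≤-trans (s≤s (element<level c p cp)) level<n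

fits⇒level< : ∀ {n} c → 3 ≤ n → FitsIn n c → level c < n
fits⇒level< (code false false none) 3≤n _ = <-≤-trans (s≤s (s≤s z≤n)) 3≤n
fits⇒level< (code true _ none) 3≤n _ = 3≤n
fits⇒level< (code false true none) 3≤n _ = 3≤n
fits⇒level< (code _ _ (chain π k)) _ fits = fits (2 + (bit π + k * 2)) (inChain-≤ π {k} ≤-refl)

data InH (n : ℕ) : Subset n → Set where
  small : ∀ {c} → Valid c → FitsIn n c → InH n (⟪ c ⟫ n)
  large : ∀ {c} → Valid c → FitsIn n c → InH n (∁ (⟪ c ⟫ n))

H-block : (n : ℕ) → ℕ → List (Subset n)
H-block n i = map fromElems (T (suc i)) ++ map (λ t → ∁ (fromElems t)) (T (suc i))

block-level⇒fits : ∀ {n i} c → i ∈ upTo (n ∸ 1) → level c ≡ suc i → FitsIn n c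
block-level⇒fits {suc n} c i∈ lc = level<⇒fits c (subst (_< suc n) (sym lc) (s≤s (∈-upTo⁻ i∈)))

∈H⇒InH : ∀ {n Y} → Y ∈ H n → InH n Y
∈H⇒InH {n} Y∈H with find (∈-concatMap⁻ (H-block n) {xs = upTo (n ∸ 1)} Y∈H)
... | i , i∈ , Y∈block with ∈-++⁻ (map fromElems (T (suc i))) Y∈block
...   | inj₁ Y∈small with ∈-map⁻ fromElems Y∈small
...     | t , t∈T , refl with ∈T⇒code (suc i) t∈T
...       | c , vc , lc , refl rewrite fromElems-elems n c = small vc (block-level⇒fits c i∈ lc)
∈H⇒InH {n} Y∈H | i , i∈ , Y∈block | inj₂ Y∈large with ∈-map⁻ (λ t → ∁ (fromElems t)) Y∈large
...     | t , t∈T , refl with ∈T⇒code (suc i) t∈T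
...       | c , vc , lc , refl rewrite fromElems-elems n c = large vc (block-level⇒fits c i∈ lc)

code∈block : ∀ {n} c → 3 ≤ n → Valid c → FitsIn n c → Σ ℕ λ i → i ∈ upTo (n ∸ 1) × elems c ∈ T (suc i)
code∈block {suc n} c 3≤n vc fits with level c | elems∈T c vc | fits⇒level< c 3≤n fits
... | suc i | elems∈ | s≤s i<n = i , ∈-upTo⁺ i<n , elems∈

InH⇒∈H : ∀ {n Y} → 3 ≤ n → InH n Y → Y ∈ H n
InH⇒∈H {n} 3≤n (small {c} vc fits) with code∈block c 3≤n vc fits
... | i , i∈ , elems∈ = ∈-concatMap⁺ (H-block n) (lose i∈ (∈-++⁺ˡ
  (subst (_∈ map fromElems (T (suc i))) (fromElems-elems n c) (∈-map⁺ fromElems elems∈))))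
InH⇒∈H {n} 3≤n (large {c} vc fits) with code∈block c 3≤n vc fits
... | i , i∈ , elems∈ = ∈-concatMap⁺ (H-block n) (lose i∈ (∈-++⁺ʳ (map fromElems (T (suc i)))
  (subst (_∈ map (λ t → ∁ (fromElems t)) (T (suc i))) (cong ∁ (fromElems-elems n c))
         (∈-map⁺ (λ t → ∁ (fromElems t)) elems∈))))

InH-∁ : ∀ {n Y} → InH n Y → InH n (∁ Y)
InH-∁ (small vc fits) = large vc fits
InH-∁ {n} (large {c} vc fits) = subst (InH n) (sym (∁-involutive (⟪ c ⟫ n))) (small vc fits)

-- H_n contains no induced butterfly

module _ {n : ℕ} where

  ⟪⟫-⊆⇒⊑ : ∀ {x y} → FitsIn n x → ⟪ x ⟫ n ⊆ ⟪ y ⟫ n → x ⊑ y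
  ⟪⟫-⊆⇒⊑ fits x⊆y = ⊆⇒⊑ fits (⊆⇒⊆! x⊆y)

  ⟪⟫-⊆∁⇒Disjoint : ∀ {x y} → FitsIn n x → ⟪ x ⟫ n ⊆ ∁ (⟪ y ⟫ n) → Disjoint x y
  ⟪⟫-⊆∁⇒Disjoint fits x⊆∁y = ⊆∁⇒Disjoint fits (⊆⇒⊆! x⊆∁y)

  ⟪⟫-incomparable : ∀ {x y} → ¬ ⟪ x ⟫ n ⊆ ⟪ y ⟫ n → ¬ ⟪ y ⟫ n ⊆ ⟪ x ⟫ n → ¬ Comparable x y
  ⟪⟫-incomparable x⊈y _ (inj₁ x⊑y) = x⊈y (⊆!⇒⊆ (⊑⇒⊆ x⊑y))
  ⟪⟫-incomparable _ y⊈x (inj₂ y⊑x) = y⊈x (⊆!⇒⊆ (⊑⇒⊆ y⊑x))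

  ∁⟪⟫-incomparable : ∀ {x y} → ¬ ∁ (⟪ x ⟫ n) ⊆ ∁ (⟪ y ⟫ n) → ¬ ∁ (⟪ y ⟫ n) ⊆ ∁ (⟪ x ⟫ n) →
                     ¬ Comparable x y
  ∁⟪⟫-incomparable _ ∁y⊈∁x (inj₁ x⊑y) = ∁y⊈∁x (⊆!⇒⊆ (∁-antitone (⊑⇒⊆ x⊑y)))
  ∁⟪⟫-incomparable ∁x⊈∁y _ (inj₂ y⊑x) = ∁x⊈∁y (⊆!⇒⊆ (∁-antitone (⊑⇒⊆ y⊑x)))

  ⟪⟫-not-disjoint : ∀ {x y} → ¬ ⟪ x ⟫ n ⊆ ∁ (⟪ y ⟫ n) → ¬ Disjoint x y
  ⟪⟫-not-disjoint x⊈∁y x∩y = x⊈∁y (⊆!⇒⊆ (Disjoint⇒⊆∁ x∩y))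

  no-butterfly-above-small-pair : ∀ {x y c d} → Valid x → Valid y → FitsIn n x → FitsIn n y → InH n c → InH n d →
                                  ¬ IsInducedButterfly (⟪ x ⟫ n) (⟪ y ⟫ n) c d
  no-butterfly-above-small-pair vx vy fx fy (small vz fz) (small vw fw) bf =
    ⟪⟫-incomparable c⊈d d⊈c (upper-bounds-comparable vx vy vz vw
      (⟪⟫-⊆⇒⊑ fx a⊆c) (⟪⟫-⊆⇒⊑ fy b⊆c) (⟪⟫-⊆⇒⊑ fx a⊆d) (⟪⟫-⊆⇒⊑ fy b⊆d)
      (⟪⟫-incomparable a⊈b b⊈a))
    where open IsInducedButterfly bf
  no-butterfly-above-small-pair vx vy fx fy (small vz fz) (large vw fw) bf =
    ⟪⟫-not-disjoint c⊈d (upper-bound-disjoint vx vy vz vw (⟪⟫-⊆⇒⊑ fx a⊆c) (⟪⟫-⊆⇒⊑ fy b⊆c)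
      (⟪⟫-⊆∁⇒Disjoint fx a⊆d) (⟪⟫-⊆∁⇒Disjoint fy b⊆d) (⟪⟫-incomparable a⊈b b⊈a))
    where open IsInducedButterfly bf
  no-butterfly-above-small-pair vx vy fx fy (large vz fz) (small vw fw) bf =
    ⟪⟫-not-disjoint d⊈c (upper-bound-disjoint vx vy vw vz (⟪⟫-⊆⇒⊑ fx a⊆d) (⟪⟫-⊆⇒⊑ fy b⊆d)
      (⟪⟫-⊆∁⇒Disjoint fx a⊆c) (⟪⟫-⊆∁⇒Disjoint fy b⊆c) (⟪⟫-incomparable a⊈b b⊈a))
    where open IsInducedButterfly bf
  no-butterfly-above-small-pair vx vy fx fy (large vz fz) (large vw fw) bf =
    disjoint-incomparable-pairs vx vy vz vw (⟪⟫-incomparable a⊈b b⊈a) (∁⟪⟫-incomparable c⊈d d⊈c)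
      (⟪⟫-⊆∁⇒Disjoint fx a⊆c) (⟪⟫-⊆∁⇒Disjoint fx a⊆d)
      (⟪⟫-⊆∁⇒Disjoint fy b⊆c) (⟪⟫-⊆∁⇒Disjoint fy b⊆d)
    where open IsInducedButterfly bf

butterfly-∁ : ∀ {n} {a b c d : Subset n} → IsInducedButterfly a b c d → IsInducedButterfly (∁ c) (∁ d) (∁ a) (∁ b)
butterfly-∁ bf = record
  { a≢b = c≢d ∘ ∁-injective ; a≢c = a≢c ∘ sym ∘ ∁-injective ; a≢d = b≢c ∘ sym ∘ ∁-injective
  ; b≢c = a≢d ∘ sym ∘ ∁-injective ; b≢d = b≢d ∘ sym ∘ ∁-injective ; c≢d = a≢b ∘ ∁-injective
  ; a⊆c = ∁-⊆ a⊆c ; a⊆d = ∁-⊆ b⊆c ; b⊆c = ∁-⊆ a⊆d ; b⊆d = ∁-⊆ b⊆d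
  ; a⊈b = d⊈c ∘ ∁-⊆⁻ ; b⊈a = c⊈d ∘ ∁-⊆⁻ ; c⊈d = b⊈a ∘ ∁-⊆⁻ ; d⊈c = a⊈b ∘ ∁-⊆⁻
  ; c⊈a = c⊈a ∘ ∁-⊆⁻ ; d⊈a = c⊈b ∘ ∁-⊆⁻ ; c⊈b = d⊈a ∘ ∁-⊆⁻ ; d⊈b = d⊈b ∘ ∁-⊆⁻
  }
  where
  open IsInducedButterfly bf
  ∁-injective : ∀ {v w : Subset _} → ∁ v ≡ ∁ w → v ≡ w
  ∁-injective {v} {w} eq = trans (sym (∁-involutive v)) (trans (cong ∁ eq) (∁-involutive w))
  ∁-⊆ : ∀ {v w : Subset _} → v ⊆ w → ∁ w ⊆ ∁ v
  ∁-⊆ = Subsetₚ.p⊆q⇒∁p⊇∁q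
  ∁-⊆⁻ : ∀ {v w : Subset _} → ∁ v ⊆ ∁ w → w ⊆ v
  ∁-⊆⁻ = Subsetₚ.∁p⊆∁q⇒p⊇q

-- A large bottom element forces large top elements, and complementing such a butterfly
-- gives one whose bottom elements are small.
H-butterfly-free : ∀ {m a b c d} → InH (suc m) a → InH (suc m) b → InH (suc m) c → InH (suc m) d →
                   ¬ IsInducedButterfly a b c d
H-butterfly-free (small va fa) (small vb fb) C D = no-butterfly-above-small-pair va vb fa fb C D
H-butterfly-free (large {x} _ fx) _ (small {z} _ fz) _ bf =
  ∁⟪⟫⊈⟪⟫ x z fx fz (⊆⇒⊆! (IsInducedButterfly.a⊆c bf))
H-butterfly-free (large {x} _ fx) _ (large _ _) (small {w} _ fw) bf =
  ∁⟪⟫⊈⟪⟫ x w fx fw (⊆⇒⊆! (IsInducedButterfly.a⊆d bf))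
H-butterfly-free (small _ _) (large {y} _ fy) (small {z} _ fz) _ bf =
  ∁⟪⟫⊈⟪⟫ y z fy fz (⊆⇒⊆! (IsInducedButterfly.b⊆c bf))
H-butterfly-free (small _ _) (large {y} _ fy) (large _ _) (small {w} _ fw) bf =
  ∁⟪⟫⊈⟪⟫ y w fy fw (⊆⇒⊆! (IsInducedButterfly.b⊆d bf))
H-butterfly-free {m} {a} {b} A B (large {z} vz fz) (large {w} vw fw) bf =
  no-butterfly-above-small-pair vz vw fz fw (InH-∁ A) (InH-∁ B)
    (subst₂ (λ c d → IsInducedButterfly c d (∁ a) (∁ b))
            (∁-involutive (⟪ z ⟫ (suc m))) (∁-involutive (⟪ w ⟫ (suc m))) (butterfly-∁ bf))

-- Sets outside H_n are blocked by earlier members of H_n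

rank-⟪⟫ : ∀ {m} c → FitsIn (suc m) c → rank (⟪ c ⟫ (suc m)) ≡ binary (⟪ c ⟫ (suc m))
rank-⟪⟫ {m} c fits = rank-low (⟪ c ⟫ (suc m)) (⟪⟫-last c fits)

rank-∁⟪⟫ : ∀ {m} c → FitsIn (suc m) c → rank (∁ (⟪ c ⟫ (suc m))) ≡ binary (⟪ c ⟫ (suc m))
rank-∁⟪⟫ {m} c fits = trans (rank-∁ (⟪ c ⟫ (suc m))) (rank-⟪⟫ c fits)

least-witness : ∀ {P : ℕ → Set} → (∀ q → Dec (P q)) → ∀ {n} → P n →
                Σ ℕ λ q → P q × (∀ {r} → r < q → ¬ P r)
least-witness {P} P? {n} Pn = search 0 n Pn λ ()
  where
  search : ∀ q d → P (q + d) → (∀ {r} → r < q → ¬ P r) → Σ ℕ λ q → P q × (∀ {r} → r < q → ¬ P r)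
  search q zero Pq+0 below = q , subst P (+-identityʳ q) Pq+0 , below
  search q (suc d) Pq+1+d below with P? q
  ... | yes Pq = q , Pq , below
  ... | no ¬Pq = search (suc q) d (subst P (+-suc q d) Pq+1+d) below′
    where
    below′ : ∀ {r} → r < suc q → ¬ P r
    below′ r<1+q with m<1+n⇒m<n∨m≡n r<1+q
    ... | inj₁ r<q = below r<q
    ... | inj₂ refl = ¬Pq

-- single i is the singleton {i + 1}.
single : Fin 3 → Code
single 0F = code true false none
single 1F = code false true none
single 2F = code false false (chain false 0)

single-valid : ∀ i → Valid (single i)
single-valid 0F = tt
single-valid 1F = tt
single-valid 2F = refl

single-self : ∀ i → ⟦ single i ⟧ (toℕ i) ≡ true
single-self 0F = refl
single-self 1F = refl
single-self 2F = refl

single-only : ∀ i p → ⟦ single i ⟧ p ≡ true → p ≡ toℕ i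
single-only 0F zero _ = refl
single-only 0F (suc zero) ()
single-only 0F (suc (suc _)) ()
single-only 1F zero ()
single-only 1F (suc zero) _ = refl
single-only 1F (suc (suc _)) ()
single-only 2F zero ()
single-only 2F (suc zero) ()
single-only 2F (suc (suc zero)) _ = refl
single-only 2F (suc (suc (suc zero))) ()
single-only 2F (suc (suc (suc (suc _)))) ()

single-other : ∀ i p → p ≢ toℕ i → ⟦ single i ⟧ p ≡ false
single-other i p p≢i with ⟦ single i ⟧ p in ip
... | false = refl
... | true = contradiction (single-only i p ip) p≢i

single-fits : ∀ {m} i → toℕ i < m → FitsIn (suc m) (single i)
single-fits i i<m p ip rewrite single-only i p ip = s≤s i<m

single-⊆ : ∀ {n} i (v : Subset n) → v ! toℕ i ≡ true → ⟪ single i ⟫ n ⊆! v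
single-⊆ {n} i v vi = ⊆!⁺ λ p ip →
  subst (λ q → v ! q ≡ true) (sym (single-only i p (⟪⟫-true⇒ (single i) {n} p ip))) vi

⊆-∁single : ∀ {n} i (v : Subset n) → v ! toℕ i ≡ false → v ⊆! ∁ (⟪ single i ⟫ n)
⊆-∁single i v vi = ⊆!⁺ λ p vp →
  trans (!-⟪⟫-∁ (single i) p (!⇒< v vp)) (cong not (single-other i p λ { refl → true≢false (trans (sym vp) vi) }))

single-⊈ : ∀ {n} i j → toℕ i ≢ toℕ j → toℕ i < n → ¬ ⟪ single i ⟫ n ⊆! ⟪ single j ⟫ n
single-⊈ i j i≢j i<n = ⊈-witness (toℕ i) (trans (!-⟪⟫ (single i) _ i<n) (single-self i))
                                         (trans (!-⟪⟫ (single j) _ i<n) (single-other j _ i≢j))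

∁single-⊈ : ∀ {n} i j → toℕ i ≢ toℕ j → toℕ j < n → ¬ ∁ (⟪ single i ⟫ n) ⊆! ∁ (⟪ single j ⟫ n)
∁single-⊈ i j i≢j j<n = ⊈-witness (toℕ j)
  (trans (!-⟪⟫-∁ (single i) _ j<n) (cong not (single-other i _ (i≢j ∘ sym))))
  (trans (!-⟪⟫-∁ (single j) _ j<n) (cong not (single-self j)))

butterfly-from-inclusions : ∀ {n} {a b c d : Subset n} → a ⊆! c → a ⊆! d → b ⊆! c → b ⊆! d →
                            ¬ a ⊆! b → ¬ b ⊆! a → ¬ c ⊆! d → ¬ d ⊆! c → IsInducedButterfly a b c d
butterfly-from-inclusions a⊆c a⊆d b⊆c b⊆d a⊈b b⊈a c⊈d d⊈c = record
  { a≢b = λ { refl → a⊈b ⊆!-refl } ; a≢c = λ { refl → c⊈d a⊆d } ; a≢d = λ { refl → d⊈c a⊆c }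
  ; b≢c = λ { refl → c⊈d b⊆d } ; b≢d = λ { refl → d⊈c b⊆c } ; c≢d = λ { refl → c⊈d ⊆!-refl }
  ; a⊆c = ⊆!⇒⊆ a⊆c ; a⊆d = ⊆!⇒⊆ a⊆d ; b⊆c = ⊆!⇒⊆ b⊆c ; b⊆d = ⊆!⇒⊆ b⊆d
  ; a⊈b = a⊈b ∘ ⊆⇒⊆! ; b⊈a = b⊈a ∘ ⊆⇒⊆! ; c⊈d = c⊈d ∘ ⊆⇒⊆! ; d⊈c = d⊈c ∘ ⊆⇒⊆!
  ; c⊈a = λ c⊆a → b⊈a (⊆!-trans b⊆c (⊆⇒⊆! c⊆a))
  ; d⊈a = λ d⊆a → b⊈a (⊆!-trans b⊆d (⊆⇒⊆! d⊆a))
  ; c⊈b = λ c⊆b → a⊈b (⊆!-trans a⊆c (⊆⇒⊆! c⊆b))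
  ; d⊈b = λ d⊆b → a⊈b (⊆!-trans a⊆d (⊆⇒⊆! d⊆b))
  }

nonconstant-valid : ∀ b₀ b₁ π k → ¬ (b₀ ≡ not π × b₁ ≡ not π) →
                    Valid (code b₀ b₁ (chain π k)) × Valid (code (not b₀) (not b₁) (chain (not π) k))
nonconstant-valid true true false _ constant = contradiction (refl , refl) constant
nonconstant-valid false false true _ constant = contradiction (refl , refl) constant
nonconstant-valid false false false _ _ = refl , refl
nonconstant-valid false true false _ _ = refl , refl
nonconstant-valid true false false _ _ = refl , refl
nonconstant-valid false true true _ _ = refl , refl
nonconstant-valid true false true _ _ = refl , refl
nonconstant-valid true true true _ _ = refl , refl

module Blocking {m : ℕ} (3≤n : 3 ≤ suc m) (X : Subset (suc m)) (X-last : X ! m ≡ false) (X∉H : ¬ InH (suc m) X)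
                 (F : List (Subset (suc m))) (earlier∈F : ∀ {Y} → InH (suc m) Y → rank Y < binary X → Y ∈ F) where

  private
    n : ℕ
    n = suc m

  X-below : ∀ {p} → X ! p ≡ true → p < m
  X-below {p} Xp = ≤∧≢⇒< (≤-pred (!⇒< X Xp)) λ { refl → true≢false (trans (sym Xp) X-last) }

  X-from-last : ∀ {p} → m ≤ p → X ! p ≡ false
  X-from-last {p} m≤p with X ! p in Xp
  ... | false = refl
  ... | true = contradiction m≤p (<⇒≱ (X-below Xp))

  i<n : ∀ (i : Fin 3) → toℕ i < n
  i<n i = <-≤-trans (toℕ<n i) 3≤n

  X-not-code : ∀ c → Valid c → (∀ p → X ! p ≡ ⟦ c ⟧ p) → ⊥
  X-not-code c vc X≗c = X∉H (subst (InH n) (sym X≡c) (small vc fits))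
    where
    fits : FitsIn n c
    fits p cp = s≤s (X-below (trans (X≗c p) cp))
    X≡c : X ≡ ⟪ c ⟫ n
    X≡c = !-ext X (⟪ c ⟫ n) λ p → trans (X≗c p) (sym (!-⟪⟫-fits c p fits))

  record Rival : Set where
    field
      set : Subset n
      X⊈set : ¬ X ⊆! set
      set⊈X : ¬ set ⊆! X
      set∈H : InH n set
      earlier : rank set < binary X

  earlier∈ : ∀ {Y} → InH n Y → rank Y < binary X → Y ∈ X ∷ F
  earlier∈ Y∈H earlier = there (earlier∈F Y∈H earlier)

  blocked-from-above : ∀ i j → toℕ i ≢ toℕ j → X ! toℕ i ≡ true → X ! toℕ j ≡ true →
                       (R : Rival) → Rival.set R ! toℕ i ≡ true → Rival.set R ! toℕ j ≡ true →
                       HasInducedButterfly (X ∷ F)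
  blocked-from-above i j i≢j Xi Xj R Ri Rj =
    ⟪ single i ⟫ n , ⟪ single j ⟫ n , X , set ,
    earlier∈ (small (single-valid i) (single-fits i (X-below Xi))) (single-earlier i j Xi Xj (i≢j ∘ sym)) ,
    earlier∈ (small (single-valid j) (single-fits j (X-below Xj))) (single-earlier j i Xj Xi i≢j) ,
    here refl , earlier∈ set∈H earlier ,
    butterfly-from-inclusions (single-⊆ i X Xi) (single-⊆ i set Ri) (single-⊆ j X Xj) (single-⊆ j set Rj)
      (single-⊈ i j i≢j (i<n i)) (single-⊈ j i (i≢j ∘ sym) (i<n j)) X⊈set set⊈X
    where
    open Rival R
    single-earlier : ∀ i j → X ! toℕ i ≡ true → X ! toℕ j ≡ true → toℕ j ≢ toℕ i →
                     rank (⟪ single i ⟫ n) < binary X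
    single-earlier i j Xi Xj j≢i = subst (_< binary X) (sym (rank-⟪⟫ (single i) (single-fits i (X-below Xi))))
      (binary-<-⊂ X (⟪ single i ⟫ n) (single-⊆ i X Xi) Xj
        (⟪⟫-false (single i) {n} (toℕ j) (single-other i _ j≢i)))

  blocked-from-below : ∀ i j → toℕ i ≢ toℕ j → X ! toℕ i ≡ false → X ! toℕ j ≡ false →
                       ∀ {s} → 2 < s → X ! s ≡ true →
                       (R : Rival) → Rival.set R ! toℕ i ≡ false → Rival.set R ! toℕ j ≡ false →
                       HasInducedButterfly (X ∷ F)
  blocked-from-below i j i≢j Xi Xj 2<s Xs R Ri Rj =
    X , set , ∁ (⟪ single i ⟫ n) , ∁ (⟪ single j ⟫ n) ,
    here refl , earlier∈ set∈H earlier , co-single-earlier i , co-single-earlier j ,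
    butterfly-from-inclusions (⊆-∁single i X Xi) (⊆-∁single j X Xj) (⊆-∁single i set Ri) (⊆-∁single j set Rj)
      X⊈set set⊈X (∁single-⊈ i j i≢j (i<n j)) (∁single-⊈ j i (i≢j ∘ sym) (i<n i))
    where
    open Rival R
    i≤2 : ∀ (i : Fin 3) → toℕ i ≤ 2
    i≤2 i = ≤-pred (toℕ<n i)
    co-single-earlier : ∀ i → ∁ (⟪ single i ⟫ n) ∈ X ∷ F
    co-single-earlier i = earlier∈ (large (single-valid i) fits)
      (subst (_< binary X) (sym (rank-∁⟪⟫ (single i) fits))
        (binary-<-above X (⟪ single i ⟫ n) (toℕ i)
          (λ r i<r → ⟪⟫-false (single i) {n} r (single-other i r (>⇒≢ i<r))) Xs (≤-<-trans (i≤2 i) 2<s)))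
      where fits = single-fits i (≤-<-trans (i≤2 i) (<-trans 2<s (X-below Xs)))

  big-element : X ! 0 ∧ X ! 1 ≡ false → Σ ℕ λ s → 2 < s × X ! s ≡ true
  big-element not-both with some-from X 3
  ... | inj₁ (s , 3≤s , Xs) = s , 3≤s , Xs
  ... | inj₂ nothing-above with X ! 2 in X₂
  ...   | true = ⊥-elim (X-not-code (code (X ! 0) (X ! 1) (chain false 0)) not-both X≗)
    where
    X≗ : ∀ p → X ! p ≡ ⟦ code (X ! 0) (X ! 1) (chain false 0) ⟧ p
    X≗ zero = refl
    X≗ (suc zero) = refl
    X≗ (suc (suc zero)) = X₂
    X≗ (suc (suc (suc zero))) = nothing-above 3 ≤-refl
    X≗ (suc (suc (suc (suc r)))) = nothing-above (4 + r) (s≤s (s≤s (s≤s z≤n)))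
  ...   | false = ⊥-elim (X-not-code (code (X ! 0) (X ! 1) none) tt X≗)
    where
    X≗ : ∀ p → X ! p ≡ ⟦ code (X ! 0) (X ! 1) none ⟧ p
    X≗ zero = refl
    X≗ (suc zero) = refl
    X≗ (suc (suc zero)) = X₂
    X≗ (suc (suc (suc r))) = nothing-above (3 + r) (s≤s (s≤s (s≤s z≤n)))

  three-rival : X ! 2 ≡ false → ∀ {s} → 2 < s → X ! s ≡ true → Rival
  three-rival X₂ {s} 2<s Xs = record
    { set = ⟪ single 2F ⟫ n
    ; X⊈set = ⊈-witness s Xs (⟪⟫-false (single 2F) {n} s (single-other 2F s (>⇒≢ 2<s)))
    ; set⊈X = ⊈-witness 2 (⟪⟫-true (single 2F) 2 fits refl) X₂
    ; set∈H = small refl fits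
    ; earlier = subst (_< binary X) (sym (rank-⟪⟫ (single 2F) fits))
        (binary-<-above X (⟪ single 2F ⟫ n) 2
          (λ r 2<r → ⟪⟫-false (single 2F) {n} r (single-other 2F r (>⇒≢ 2<r))) Xs 2<s)
    }
    where fits = single-fits 2F (<-trans 2<s (X-below Xs))

  co-three-rival : X ! 0 ≡ true → X ! 2 ≡ true → Rival
  co-three-rival X₀ X₂ = record
    { set = ∁ (⟪ single 2F ⟫ n)
    ; X⊈set = ⊈-witness 2 X₂ (trans (!-⟪⟫-∁ (single 2F) 2 (!⇒< X X₂)) refl)
    ; set⊈X = ⊈-witness m (trans (!-∁ (⟪ single 2F ⟫ n) ≤-refl) (cong not (⟪⟫-last (single 2F) fits))) X-last
    ; set∈H = large refl fits
    ; earlier = subst (_< binary X) (sym (rank-∁⟪⟫ (single 2F) fits))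
        (binary-<-⊂ X (⟪ single 2F ⟫ n) (single-⊆ 2F X X₂) X₀ (⟪⟫-false (single 2F) {n} 0 refl))
    }
    where fits = single-fits 2F (X-below X₂)

  Agrees : Subset n → Set
  Agrees R = ∀ (i : Fin 3) → R ! toℕ i ≡ X ! toℕ i

  -- If X contains some but not all of 1, 2, 3, a rival agreeing with X on {1, 2, 3} is read
  -- off the first q with X ! (2 + q) ≢ onChain π q.
  module NonconstantRival (π : Bool) (X₂ : X ! 2 ≡ not π) (nonconstant : ¬ (X ! 0 ≡ not π × X ! 1 ≡ not π)) where

    follow oppose : ℕ → Code
    follow k = code (X ! 0) (X ! 1) (chain π k)
    oppose k = code (not (X ! 0)) (not (X ! 1)) (chain (not π) k)

    follow-agrees : ∀ k → FitsIn n (follow k) → Agrees (⟪ follow k ⟫ n)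
    follow-agrees k fits 0F = !-⟪⟫-fits (follow k) 0 fits
    follow-agrees k fits 1F = !-⟪⟫-fits (follow k) 1 fits
    follow-agrees k fits 2F = trans (!-⟪⟫-fits (follow k) 2 fits) (sym X₂)

    oppose-agrees : ∀ k → Agrees (∁ (⟪ oppose k ⟫ n))
    oppose-agrees k 0F = trans (!-⟪⟫-∁ (oppose k) 0 (i<n 0F)) (Boolₚ.not-involutive _)
    oppose-agrees k 1F = trans (!-⟪⟫-∁ (oppose k) 1 (i<n 1F)) (Boolₚ.not-involutive _)
    oppose-agrees k 2F = trans (!-⟪⟫-∁ (oppose k) 2 (i<n 2F)) (trans (Boolₚ.not-involutive _) (sym X₂))

    Deviates : ℕ → Set
    Deviates q = X ! (2 + q) ≢ onChain π q

    first-deviation : Σ ℕ λ q → Deviates q × (∀ {r} → r < q → ¬ Deviates r)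
    first-deviation = least-witness (λ q → ¬? (X ! (2 + q) Bool.≟ onChain π q)) {bit π + m * 2} far
      where
      far : Deviates (bit π + m * 2)
      far eq = true≢false (trans (sym (onChain-bit π m)) (trans (sym eq) (X-from-last m≤)))
        where m≤ = ≤-trans (m≤m*n m 2) (≤-trans (m≤n+m (m * 2) (bit π)) (m≤n+m _ 2))

    valid : ∀ k → Valid (follow k) × Valid (oppose k)
    valid k = nonconstant-valid (X ! 0) (X ! 1) π k nonconstant

    follow-fits : ∀ k {s} → 2 + (bit π + k * 2) < s → X ! s ≡ true → FitsIn n (follow k)
    follow-fits k top<s Xs p fp = s≤s (<-trans (<-≤-trans (element<level (follow k) p fp) top<s) (X-below Xs))

    follow-rival : ∀ k {s} → X ! (2 + (bit π + k * 2)) ≡ false → 2 + (bit π + k * 2) < s → X ! s ≡ true → Rival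
    follow-rival k {s} X-top top<s Xs = record
      { set = ⟪ follow k ⟫ n
      ; X⊈set = ⊈-witness s Xs (⟪⟫-false (follow k) {n} s (⟦chain⟧-above _ _ π k s top<s))
      ; set⊈X = ⊈-witness t (⟪⟫-true (follow k) t fits (inChain-≤ π {k} ≤-refl)) X-top
      ; set∈H = small (proj₁ (valid k)) fits
      ; earlier = subst (_< binary X) (sym (rank-⟪⟫ (follow k) fits))
          (binary-<-above X (⟪ follow k ⟫ n) (2 + (bit π + k * 2))
            (λ r top<r → ⟪⟫-false (follow k) {n} r (⟦chain⟧-above _ _ π k r top<r)) Xs top<s)
      }
      where
      t = 2 + (bit π + k * 2)
      fits = follow-fits k top<s Xs

    oppose-fits : ∀ k → X ! (2 + (bit (not π) + k * 2)) ≡ true → FitsIn n (oppose k)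
    oppose-fits k X-top p op = s≤s (<-≤-trans (element<level (oppose k) p op) (X-below X-top))

    oppose-rival : ∀ k → X ! (2 + (bit (not π) + k * 2)) ≡ true → binary (⟪ oppose k ⟫ n) < binary X → Rival
    oppose-rival k X-top earlier = record
      { set = ∁ (⟪ oppose k ⟫ n)
      ; X⊈set = ⊈-witness t X-top
          (trans (!-∁ (⟪ oppose k ⟫ n) (<⇒≤ (fits t top))) (cong not (⟪⟫-true (oppose k) t fits top)))
      ; set⊈X = ⊈-witness m (trans (!-∁ (⟪ oppose k ⟫ n) ≤-refl) (cong not (⟪⟫-last (oppose k) fits))) X-last
      ; set∈H = large (proj₂ (valid k)) fits
      ; earlier = subst (_< binary X) (sym (rank-∁⟪⟫ (oppose k) fits)) earlier
      }
      where
      t = 2 + (bit (not π) + k * 2)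
      fits = oppose-fits k X-top
      top = inChain-≤ (not π) {k} ≤-refl

    no-gap : ∀ k → (∀ {r} → r < bit π + k * 2 → X ! (2 + r) ≡ onChain π r) →
             X ! (2 + (bit π + k * 2)) ≡ false → (∀ s → 3 + (bit π + k * 2) ≤ s → X ! s ≡ false) → ⊥
    no-gap k follows X-top nothing-above = X-not-code (code (X ! 0) (X ! 1) (chain-before π k)) (valid-before k) X≗
      where
      valid-before : ∀ k → Valid (code (X ! 0) (X ! 1) (chain-before π k))
      valid-before zero = tt
      valid-before (suc k) = proj₁ (valid k)
      X≗ : ∀ p → X ! p ≡ ⟦ code (X ! 0) (X ! 1) (chain-before π k) ⟧ p
      X≗ zero = refl
      X≗ (suc zero) = refl
      X≗ (suc (suc r)) with <-cmp r (bit π + k * 2)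
      ... | tri< r<top _ _ = trans (follows r<top) (sym (chain-before-below π k r r<top))
      ... | tri≈ _ refl _ = trans X-top (sym (chain-before-above π k r ≤-refl))
      ... | tri> _ _ top<r = trans (nothing-above (2 + r) (s≤s (s≤s top<r))) (sym (chain-before-above π k r (<⇒≤ top<r)))

    oppose-vanish : ∀ k q → suc q ≡ bit (not π) + k * 2 → ∀ r → 3 + q < r → ⟪ oppose k ⟫ n ! r ≡ false
    oppose-vanish k q top≡ r top<r =
      ⟪⟫-false (oppose k) {n} r (⟦chain⟧-above _ _ (not π) k r (subst (λ t → 2 + t < r) top≡ top<r))

    oppose-earlier : ∀ k q → suc q ≡ bit (not π) + k * 2 → onChain π q ≡ true →
                     X ! (2 + q) ≡ true → X ! (3 + q) ≡ true → binary (⟪ oppose k ⟫ n) < binary X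
    oppose-earlier k q top≡ on X-prev X-top with some-from X (4 + q)
    ... | inj₁ (s , top<s , Xs) = binary-<-above X (⟪ oppose k ⟫ n) (3 + q) (oppose-vanish k q top≡) Xs top<s
    ... | inj₂ nothing-above = binary-<-highest-difference X (⟪ oppose k ⟫ n) {2 + q} X-prev
      (⟪⟫-false (oppose k) {n} (2 + q) (inChain-off (not π) k q (trans (onChain-not π q) (cong not on)))) agree
      where
      agree : ∀ r → 2 + q < r → X ! r ≡ ⟪ oppose k ⟫ n ! r
      agree r prev<r with m≤n⇒m<n∨m≡n prev<r
      ... | inj₁ top<r = trans (nothing-above r top<r) (sym (oppose-vanish k q top≡ r top<r))
      ... | inj₂ refl = trans X-top (sym (⟪⟫-true (oppose k) (3 + q)
                          (oppose-fits k (subst (λ t → X ! (2 + t) ≡ true) top≡ X-top))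
                          (subst (λ t → inChain (not π) k t ≡ true) (sym top≡) (inChain-≤ (not π) {k} ≤-refl))))

    follows : ∀ {q} → (∀ {r} → r < q → ¬ Deviates r) → ∀ {r} → r < q → X ! (2 + r) ≡ onChain π r
    follows before {r} r<q = decidable-stable (X ! (2 + r) Bool.≟ onChain π r) (before r<q)

    rival : Σ Rival λ R → Agrees (Rival.set R)
    rival with first-deviation
    ... | q , deviates , before with X ! (2 + q) in Xq
    ...   | false with onChain⇒ π q (Boolₚ.¬-not (deviates ∘ sym))
    ...     | k , refl with some-from X (3 + (bit π + k * 2))
    ...       | inj₁ (s , top<s , Xs) = follow-rival k Xq top<s Xs , follow-agrees k (follow-fits k top<s Xs)
    ...       | inj₂ nothing-above = ⊥-elim (no-gap k (follows before) Xq nothing-above)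
    rival | zero , deviates , _ | true = ⊥-elim (deviates (trans (sym Xq) X₂))
    rival | suc q , deviates , before | true with onChain⇒ (not π) (suc q) (trans (onChain-not π (suc q)) (cong not off))
      where off = Boolₚ.¬-not (deviates ∘ sym)
    ... | k , top≡ = oppose-rival k (subst (λ t → X ! (2 + t) ≡ true) top≡ Xq) (oppose-earlier k q top≡ on X-prev Xq) ,
                     oppose-agrees k
      where
      on : onChain π q ≡ true
      on = Boolₚ.not-injective (trans (sym (onChain-suc π q)) (Boolₚ.¬-not (deviates ∘ sym)))
      X-prev = trans (follows before (n<1+n q)) on

  blocked-by-agreeing-above : ∀ i j → toℕ i ≢ toℕ j → X ! toℕ i ≡ true → X ! toℕ j ≡ true →
                              Σ Rival (Agrees ∘ Rival.set) → HasInducedButterfly (X ∷ F)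
  blocked-by-agreeing-above i j i≢j Xi Xj (R , agrees) =
    blocked-from-above i j i≢j Xi Xj R (trans (agrees i) Xi) (trans (agrees j) Xj)

  blocked-by-agreeing-below : ∀ i j → toℕ i ≢ toℕ j → X ! toℕ i ≡ false → X ! toℕ j ≡ false →
                              X ! 0 ∧ X ! 1 ≡ false → Σ Rival (Agrees ∘ Rival.set) → HasInducedButterfly (X ∷ F)
  blocked-by-agreeing-below i j i≢j Xi Xj not-both (R , agrees) with big-element not-both
  ... | s , 2<s , Xs = blocked-from-below i j i≢j Xi Xj 2<s Xs R (trans (agrees i) Xi) (trans (agrees j) Xj)

  blocked : HasInducedButterfly (X ∷ F)
  blocked with X ! 0 in X₀ | X ! 1 in X₁ | X ! 2 in X₂
  ... | true | true | true = blocked-from-above 0F 1F (λ ()) X₀ X₁ (co-three-rival X₀ X₂)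
    (!-⟪⟫-∁ (single 2F) 0 (i<n 0F)) (!-⟪⟫-∁ (single 2F) 1 (i<n 1F))
  ... | false | false | false with big-element (cong₂ _∧_ X₀ X₁)
  ...   | s , 2<s , Xs = blocked-from-below 0F 1F (λ ()) X₀ X₁ 2<s Xs (three-rival X₂ 2<s Xs)
                           (⟪⟫-false (single 2F) {n} 0 refl) (⟪⟫-false (single 2F) {n} 1 refl)
  blocked | true | true | false = blocked-by-agreeing-above 0F 1F (λ ()) X₀ X₁
    (NonconstantRival.rival true X₂ λ (e , _) → true≢false (trans (sym X₀) e))
  blocked | true | false | true = blocked-by-agreeing-above 0F 2F (λ ()) X₀ X₂
    (NonconstantRival.rival false X₂ λ (_ , e) → true≢false (trans (sym e) X₁))
  blocked | false | true | true = blocked-by-agreeing-above 1F 2F (λ ()) X₁ X₂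
    (NonconstantRival.rival false X₂ λ (e , _) → true≢false (trans (sym e) X₀))
  blocked | true | false | false = blocked-by-agreeing-below 1F 2F (λ ()) X₁ X₂ (cong₂ _∧_ X₀ X₁)
    (NonconstantRival.rival true X₂ λ (e , _) → true≢false (trans (sym X₀) e))
  blocked | false | true | false = blocked-by-agreeing-below 0F 2F (λ ()) X₀ X₂ (cong₂ _∧_ X₀ X₁)
    (NonconstantRival.rival true X₂ λ (_ , e) → true≢false (trans (sym X₁) e))
  blocked | false | false | true = blocked-by-agreeing-below 0F 1F (λ ()) X₀ X₁ (cong₂ _∧_ X₀ X₁)
    (NonconstantRival.rival false X₂ λ (e , _) → true≢false (trans (sym e) X₀))

-- The greedy colex process

fromBinary : ∀ m → ℕ → Vec Bool m
fromBinary zero _ = []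
fromBinary (suc m) s = proj₁ (halve s) ∷ fromBinary m (proj₂ (halve s))

binary-fromBinary : ∀ m s → s < 2 ^ m → binary (fromBinary m s) ≡ s
binary-fromBinary zero zero _ = refl
binary-fromBinary zero (suc s) (s≤s ())
binary-fromBinary (suc m) s s<2^1+m =
  trans (cong (λ b → bit (proj₁ (halve s)) + b * 2) (binary-fromBinary m (proj₂ (halve s)) half<)) (halve-inverse s)
  where
  half< : proj₂ (halve s) < 2 ^ m
  half< = *-cancelʳ-< 2 _ _ (begin-strict
    proj₂ (halve s) * 2                              ≤⟨ m≤n+m _ (bit (proj₁ (halve s))) ⟩
    bit (proj₁ (halve s)) + proj₂ (halve s) * 2      ≡⟨ halve-inverse s ⟩
    s                                                <⟨ s<2^1+m ⟩
    2 ^ suc m                                        ≡⟨ *-comm 2 (2 ^ m) ⟩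
    2 ^ m * 2                                        ∎)
    where open ≤-Reasoning

doubling : ∀ {m} (g : ℕ → Vec Bool m) k →
           concatMap (λ r → (false ∷ r) ∷ (true ∷ r) ∷ []) (applyUpTo g k) ≡
           applyUpTo (λ s → proj₁ (halve s) ∷ g (proj₂ (halve s))) (k * 2)
doubling g zero = refl
doubling g (suc k) = cong (λ rest → (false ∷ g 0) ∷ (true ∷ g 0) ∷ rest) (doubling (g ∘ suc) k)

colex-binary : ∀ m → colex m ≡ applyUpTo (fromBinary m) (2 ^ m)
colex-binary zero = refl
colex-binary (suc m) = begin
  concatMap (λ r → (false ∷ r) ∷ (true ∷ r) ∷ []) (colex m)
    ≡⟨ cong (concatMap _) (colex-binary m) ⟩
  concatMap (λ r → (false ∷ r) ∷ (true ∷ r) ∷ []) (applyUpTo (fromBinary m) (2 ^ m))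
    ≡⟨ doubling (fromBinary m) (2 ^ m) ⟩
  applyUpTo (fromBinary (suc m)) (2 ^ m * 2)
    ≡⟨ cong (applyUpTo _) (*-comm (2 ^ m) 2) ⟩
  applyUpTo (fromBinary (suc m)) (2 ^ suc m) ∎
  where open ≡-Reasoning

-- The set F_{s + 1} of the process: the subset of [n - 1] with binary value s.
colexAt : ∀ m → ℕ → Subset (suc m)
colexAt m s = fromBinary m s ∷ʳ false

colexLow-binary : ∀ m → colexLow (suc m) ≡ applyUpTo (colexAt m) (2 ^ m)
colexLow-binary m =
  trans (cong (map (_∷ʳ false)) (colex-binary m)) (Listₚ.map-applyUpTo (fromBinary m) (_∷ʳ false) (2 ^ m))

!-∷ʳ : ∀ {k} (v : Vec Bool k) b → (v ∷ʳ b) ! k ≡ b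
!-∷ʳ [] b = refl
!-∷ʳ (_ ∷ v) b = !-∷ʳ v b

binary-∷ʳ-false : ∀ {k} (v : Vec Bool k) → binary (v ∷ʳ false) ≡ binary v
binary-∷ʳ-false [] = refl
binary-∷ʳ-false (b ∷ v) = cong (λ r → bit b + r * 2) (binary-∷ʳ-false v)

low-colexAt : ∀ m (Y : Subset (suc m)) → Y ! m ≡ false → Y ≡ colexAt m (binary Y)
low-colexAt zero (false ∷ []) _ = refl
low-colexAt (suc m) (b ∷ Y) Ym rewrite halve-bit b (binary Y) = cong (b ∷_) (low-colexAt m Y Ym)

colexAt-last : ∀ m s → colexAt m s ! m ≡ false
colexAt-last m s = !-∷ʳ (fromBinary m s) false

rank-colexAt : ∀ m s → s < 2 ^ m → rank (colexAt m s) ≡ s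
rank-colexAt m s s<2^m = begin
  rank (colexAt m s)                  ≡⟨ rank-low (colexAt m s) (colexAt-last m s) ⟩
  binary (fromBinary m s ∷ʳ false)    ≡⟨ binary-∷ʳ-false (fromBinary m s) ⟩
  binary (fromBinary m s)             ≡⟨ binary-fromBinary m s s<2^m ⟩
  s                                   ∎
  where open ≡-Reasoning

rank<2^ : ∀ {m} (Y : Subset (suc m)) → rank Y < 2 ^ m
rank<2^ {m} Y with Y ! m in Ym
... | false = binary<2^ Y m (vanish Y Ym)
  where
  vanish : ∀ (Z : Subset (suc m)) → Z ! m ≡ false → ∀ q → m ≤ q → Z ! q ≡ false
  vanish Z Zm q m≤q with m≤n⇒m<n∨m≡n m≤q
  ... | inj₁ m<q = !-≥ Z m<q
  ... | inj₂ refl = Zm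
... | true = binary<2^ (∁ Y) m vanish
  where
  vanish : ∀ q → m ≤ q → ∁ Y ! q ≡ false
  vanish q m≤q with m≤n⇒m<n∨m≡n m≤q
  ... | inj₁ m<q = !-≥ (∁ Y) m<q
  ... | inj₂ refl = !-last-∁ Y Ym

colexAt-rank : ∀ {m} (Y : Subset (suc m)) → Y ≡ colexAt m (rank Y) ⊎ Y ≡ ∁ (colexAt m (rank Y))
colexAt-rank {m} Y with Y ! m in Ym
... | false = inj₁ (low-colexAt m Y Ym)
... | true = inj₂ (trans (sym (∁-involutive Y)) (cong ∁ (low-colexAt m (∁ Y) (!-last-∁ Y Ym))))

TryAdd-deterministic : ∀ {n} {F F₁ F₂ : List (Subset n)} {X} → TryAdd F X F₁ → TryAdd F X F₂ → F₁ ≡ F₂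
TryAdd-deterministic (added _) (added _) = refl
TryAdd-deterministic (skipped _) (skipped _) = refl
TryAdd-deterministic (added free) (skipped blocked) = contradiction blocked free
TryAdd-deterministic (skipped blocked) (added free) = contradiction blocked free

Run-deterministic : ∀ {n} {F Xs R₁ R₂ : List (Subset n)} → Run F Xs R₁ → Run F Xs R₂ → R₁ ≡ R₂
Run-deterministic done done = refl
Run-deterministic (step s₁ t₁ r₁) (step s₂ t₂ r₂) with TryAdd-deterministic s₁ s₂
... | refl with TryAdd-deterministic t₁ t₂
...   | refl = Run-deterministic r₁ r₂

Run-∷ʳ : ∀ {n} {F G G′ R Xs : List (Subset n)} {X} → Run F Xs G → TryAdd G X G′ → TryAdd G′ (∁ X) R →
         Run F (Xs List.∷ʳ X) R
Run-∷ʳ done t₁ t₂ = step t₁ t₂ done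
Run-∷ʳ (step s₁ s₂ r) t₁ t₂ = step s₁ s₂ (Run-∷ʳ r t₁ t₂)

butterfly-∁-closed : ∀ {n} {X : Subset n} {F} → (∀ {Y} → Y ∈ F → ∁ Y ∈ F) →
                     HasInducedButterfly (X ∷ F) → HasInducedButterfly (∁ X ∷ F)
butterfly-∁-closed {X = X} {F} closed (a , b , c , d , a∈ , b∈ , c∈ , d∈ , bf) =
  ∁ c , ∁ d , ∁ a , ∁ b , ∁∈ c∈ , ∁∈ d∈ , ∁∈ a∈ , ∁∈ b∈ , butterfly-∁ bf
  where
  ∁∈ : ∀ {Y} → Y ∈ X ∷ F → ∁ Y ∈ ∁ X ∷ F
  ∁∈ (here refl) = here refl
  ∁∈ (there Y∈F) = there (closed Y∈F)

H-family-butterfly-free : ∀ {m} {G : List (Subset (suc m))} → (∀ {Y} → Y ∈ G → InH (suc m) Y) →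
                          ¬ HasInducedButterfly G
H-family-butterfly-free inH (a , b , c , d , a∈ , b∈ , c∈ , d∈ , bf) =
  H-butterfly-free (inH a∈) (inH b∈) (inH c∈) (inH d∈) bf

module Process {m : ℕ} (3≤n : 3 ≤ suc m) where

  private
    n : ℕ
    n = suc m

  InH? : ∀ Y → Dec (InH n Y)
  InH? Y = Dec.map′ ∈H⇒InH (InH⇒∈H 3≤n) (DecMembership._∈?_ (Vecₚ.≡-dec Bool._≟_) Y (H n))

  admit : ∀ {Y} → Dec (InH n Y) → List (Subset n) → List (Subset n)
  admit {Y} (yes _) F = ∁ Y ∷ Y ∷ F
  admit (no _) F = F

  Fam : ℕ → List (Subset n)
  Fam zero = []
  Fam (suc s) = admit (InH? (colexAt m s)) (Fam s)

  Fam-sound : ∀ s → s ≤ 2 ^ m → ∀ {Y} → Y ∈ Fam s → InH n Y × rank Y < s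
  Fam-sound (suc s) s<2^m Y∈ with InH? (colexAt m s)
  ... | no _ = Product.map₂ m<n⇒m<1+n (Fam-sound s (<⇒≤ s<2^m) Y∈)
  ... | yes inH with Y∈
  ...   | here refl = InH-∁ inH , ≤-reflexive (cong suc (trans (rank-∁ (colexAt m s)) (rank-colexAt m s s<2^m)))
  ...   | there (here refl) = inH , ≤-reflexive (cong suc (rank-colexAt m s s<2^m))
  ...   | there (there Y∈′) = Product.map₂ m<n⇒m<1+n (Fam-sound s (<⇒≤ s<2^m) Y∈′)

  Fam-complete : ∀ s → s ≤ 2 ^ m → ∀ {Y} → InH n Y → rank Y < s → Y ∈ Fam s
  Fam-complete (suc s) s<2^m {Y} inH rank< with InH? (colexAt m s) | m<1+n⇒m<n∨m≡n rank<
  ... | yes _ | inj₁ rank<s = there (there (Fam-complete s (<⇒≤ s<2^m) inH rank<s))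
  ... | no _ | inj₁ rank<s = Fam-complete s (<⇒≤ s<2^m) inH rank<s
  ... | yes _ | inj₂ refl with colexAt-rank Y
  ...   | inj₁ Y≡ = there (here Y≡)
  ...   | inj₂ Y≡ = here Y≡
  Fam-complete (suc s) s<2^m {Y} inH rank< | no ¬inH | inj₂ refl with colexAt-rank Y
  ...   | inj₁ Y≡ = contradiction (subst (InH n) Y≡ inH) ¬inH
  ...   | inj₂ Y≡ = contradiction (subst (InH n) (trans (cong ∁ Y≡) (∁-involutive _)) (InH-∁ inH)) ¬inH

  Fam-∁-closed : ∀ s → s ≤ 2 ^ m → ∀ {Y} → Y ∈ Fam s → ∁ Y ∈ Fam s
  Fam-∁-closed s s≤ {Y} Y∈ with Fam-sound s s≤ Y∈
  ... | inH , rank< = Fam-complete s s≤ (InH-∁ inH) (subst (_< s) (sym (rank-∁ Y)) rank<)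

  round : ∀ s → s < 2 ^ m →
          Σ (List (Subset n)) λ G → TryAdd (Fam s) (colexAt m s) G × TryAdd G (∁ (colexAt m s)) (Fam (suc s))
  round s s<2^m with InH? (colexAt m s)
  ... | yes inH = _ , added (H-family-butterfly-free inH∷) ,
                     added (H-family-butterfly-free λ { (here refl) → InH-∁ inH ; (there Y∈) → inH∷ Y∈ })
    where
    inH∷ : ∀ {Y} → Y ∈ colexAt m s ∷ Fam s → InH n Y
    inH∷ (here refl) = inH
    inH∷ (there Y∈) = proj₁ (Fam-sound s (<⇒≤ s<2^m) Y∈)
  ... | no ¬inH = _ , skipped blocked , skipped (butterfly-∁-closed (Fam-∁-closed s (<⇒≤ s<2^m)) blocked)
    where
    binary-X : binary (colexAt m s) ≡ s
    binary-X = trans (sym (rank-low (colexAt m s) (colexAt-last m s))) (rank-colexAt m s s<2^m)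
    blocked = Blocking.blocked 3≤n (colexAt m s) (colexAt-last m s) ¬inH (Fam s)
                (λ inH rank< → Fam-complete s (<⇒≤ s<2^m) inH (subst (_ <_) binary-X rank<))

  run : ∀ N → N ≤ 2 ^ m → Run [] (applyUpTo (colexAt m) N) (Fam N)
  run zero _ = done
  run (suc N) N<2^m with round N N<2^m
  ... | _ , t₁ , t₂ = subst (λ Xs → Run [] Xs (Fam (suc N))) (Listₚ.applyUpTo-∷ʳ (colexAt m) N)
                             (Run-∷ʳ (run N (<⇒≤ N<2^m)) t₁ t₂)

  output : GreedyColexOutput n (Fam (2 ^ m))
  output = subst (λ Xs → Run [] Xs (Fam (2 ^ m))) (sym (colexLow-binary m)) (run (2 ^ m) ≤-refl)

  output-is-H : ∀ X → (X ∈ Fam (2 ^ m)) ⇔ (X ∈ H n)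
  output-is-H X = mk⇔ (InH⇒∈H 3≤n ∘ proj₁ ∘ Fam-sound (2 ^ m) ≤-refl)
                      (λ X∈H → Fam-complete (2 ^ m) ≤-refl (∈H⇒InH X∈H) (rank<2^ X))

  outputs-are-H : ∀ R → GreedyColexOutput n R → ∀ X → (X ∈ R) ⇔ (X ∈ H n)
  outputs-are-H R R-output rewrite Run-deterministic R-output output = output-is-H

module Saturation {m : ℕ} (3≤n : 3 ≤ suc m) where

  private
    n : ℕ
    n = suc m

  H-distinct : List (Subset n)
  H-distinct = deduplicate (Vecₚ.≡-dec Bool._≟_) (H n)

  H-distinct-unique : Unique H-distinct
  H-distinct-unique = UniqueDecₚ.deduplicate-! (Vecₚ.≡-dec Bool._≟_) (H n)

  InH⇒∈H-distinct : ∀ {Y} → InH n Y → Y ∈ H-distinct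
  InH⇒∈H-distinct = ∈-deduplicate⁺ (Vecₚ.≡-dec Bool._≟_) ∘ InH⇒∈H 3≤n

  ∈H-distinct⇒InH : ∀ {Y} → Y ∈ H-distinct → InH n Y
  ∈H-distinct⇒InH = ∈H⇒InH ∘ ∈-deduplicate⁻ (Vecₚ.≡-dec Bool._≟_) (H n)

  H-distinct-saturating : IsButterflySaturating H-distinct
  H-distinct-saturating = H-family-butterfly-free ∈H-distinct⇒InH , saturated
    where
    blocked : ∀ {X} → X ! m ≡ false → ¬ InH n X → HasInducedButterfly (X ∷ H-distinct)
    blocked {X} X-last X∉H = Blocking.blocked 3≤n X X-last X∉H H-distinct (λ inH _ → InH⇒∈H-distinct inH)
    saturated : ∀ G → ¬ G ∈ H-distinct → HasInducedButterfly (G ∷ H-distinct)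
    saturated G G∉ with G ! m in G-last
    ... | false = blocked G-last (G∉ ∘ InH⇒∈H-distinct)
    ... | true = subst (λ Z → HasInducedButterfly (Z ∷ H-distinct)) (∁-involutive G)
      (butterfly-∁-closed (InH⇒∈H-distinct ∘ InH-∁ ∘ ∈H-distinct⇒InH)
        (blocked (!-last-∁ G G-last) λ inH → G∉ (InH⇒∈H-distinct (subst (InH n) (∁-involutive G) (InH-∁ inH)))))

-- The size of H_n

length-T : ∀ j → 2 ≤ j → length (T j) ≡ 3
length-T 1 (s≤s ())
length-T 2 _ = refl
length-T 3 _ = refl
length-T j@(suc (suc (suc (suc _)))) _ with j % 2
... | zero = refl
... | suc _ = refl

length-concatMap-const : ∀ {A B : Set} (f : A → List B) c xs → (∀ x → length (f x) ≡ c) →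
                         length (concatMap f xs) ≡ c * length xs
length-concatMap-const f c [] _ = sym (*-zeroʳ c)
length-concatMap-const f c (x ∷ xs) |f|≡c = begin
  length (f x ++ concatMap f xs)          ≡⟨ Listₚ.length-++ (f x) ⟩
  length (f x) + length (concatMap f xs)  ≡⟨ cong₂ _+_ (|f|≡c x) (length-concatMap-const f c xs |f|≡c) ⟩
  c + c * length xs                       ≡⟨ *-suc c (length xs) ⟨
  c * suc (length xs)                     ∎
  where open ≡-Reasoning

length-H-block : ∀ n i → length (H-block n i) ≡ length (T (suc i)) + length (T (suc i))
length-H-block n i = trans (Listₚ.length-++ (map fromElems (T (suc i))))
  (cong₂ _+_ (Listₚ.length-map fromElems (T (suc i))) (Listₚ.length-map (λ t → ∁ (fromElems t)) (T (suc i))))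

length-H : ∀ k → length (H (2 + k)) ≡ 2 + 6 * k
length-H k = begin
  length (H-block (2 + k) 0 ++ concatMap (H-block (2 + k)) (applyUpTo suc k))
    ≡⟨ Listₚ.length-++ (H-block (2 + k) 0) {concatMap (H-block (2 + k)) (applyUpTo suc k)} ⟩
  2 + length (concatMap (H-block (2 + k)) (applyUpTo suc k))
    ≡⟨ cong (λ xs → 2 + length (concatMap (H-block (2 + k)) xs)) (Listₚ.map-upTo suc k) ⟨
  2 + length (concatMap (H-block (2 + k)) (map suc (upTo k)))
    ≡⟨ cong (λ xs → 2 + length xs) (Listₚ.concatMap-map (H-block (2 + k)) suc (upTo k)) ⟩
  2 + length (concatMap (H-block (2 + k) ∘ suc) (upTo k))
    ≡⟨ cong (2 +_) (length-concatMap-const _ 6 (upTo k) six) ⟩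
  2 + 6 * length (upTo k)
    ≡⟨ cong (λ l → 2 + 6 * l) (Listₚ.length-upTo k) ⟩
  2 + 6 * k ∎
  where
  open ≡-Reasoning
  six : ∀ i → length (H-block (2 + k) (suc i)) ≡ 6
  six i = trans (length-H-block (2 + k) (suc i))
                (cong₂ _+_ (length-T (2 + i) (s≤s (s≤s z≤n))) (length-T (2 + i) (s≤s (s≤s z≤n))))

2+6k≡6n∸10 : ∀ k → 2 + 6 * k ≡ 6 * (2 + k) ∸ 10
2+6k≡6n∸10 k = sym (begin
  6 * (2 + k) ∸ 10      ≡⟨ cong (_∸ 10) (*-distribˡ-+ 6 2 k) ⟩
  10 + (2 + 6 * k) ∸ 10  ≡⟨ m+n∸m≡n 10 (2 + 6 * k) ⟩
  2 + 6 * k             ∎)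
  where open ≡-Reasoning

theorem25 : (n : ℕ) → 3 ≤ n →
    (Σ (List (Subset n)) λ R → GreedyColexOutput n R × ((X : Subset n) → (X ∈ R) ⇔ (X ∈ H n)))
    × ((R : List (Subset n)) → GreedyColexOutput n R → (X : Subset n) → (X ∈ R) ⇔ (X ∈ H n))
    × (Σ (List (Subset n)) λ F → Unique F × IsButterflySaturating F × length F ≤ 6 * n ∸ 10)
theorem25 1 (s≤s ())
theorem25 (suc (suc k)) 3≤n =
  (Fam (2 ^ suc k) , output , output-is-H) , outputs-are-H ,
  (H-distinct , H-distinct-unique , H-distinct-saturating , size)
  where
  open Process 3≤n
  open Saturation 3≤n
  size : length H-distinct ≤ 6 * (2 + k) ∸ 10
  size = ≤-trans (Listₚ.length-deduplicate (Vecₚ.≡-dec Bool._≟_) (H (2 + k)))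
                 (≤-reflexive (trans (length-H k) (2+6k≡6n∸10 k)))
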